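{- Let $G$ be a finite loopless graph containing no clique on $D+1$ vertices and with $\Delta(G)\leq D$. Let $k\geq 1$ and let $D=\sum_{i=1}^{k}\alpha_i$, where $\alpha_1,\dots,\alpha_k\geq 2$ are integers. Let $\Xi$ be the set of all (not necessarily proper) colorings $\psi:V(G)\to\{1,\dots,k\}$, and for $\psi\in\Xi$ let $\Phi(\psi)=\sum_{i=1}^{k}\frac{f_i(\psi)}{\alpha_i}$, where $f_i(\psi)$ is the number of edges of $G$ both of whose endpoints have color $i$ under $\psi$. Then there is a coloring $\xi\in\Xi$ such that: (1) $\Phi(\xi)=\min_{\psi\in\Xi}\Phi(\psi)$, and (2) for every $1\leq i\leq k$, there is no clique in $G$ on $\alpha_i+1$ vertices all of which have color $i$ under $\xi$. -}

module Defs where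

open import Data.Nat using (ℕ; zero; suc; _≤_; _+_)
open import Data.Fin using (Fin; _<?_; _≟_)
open import Data.List using (tabulate)
open import Data.Nat.ListAction using (sum)
open import Data.Bool using (Bool; true; false; if_then_else_; _∧_)
open import Data.Integer using (+_)
open import Data.Rational using (ℚ; 0ℚ; _/_)
import Data.Rational as ℚ
open import Relation.Nullary.Decidable using (⌊_⌋)
open import Relation.Binary.PropositionalEquality using (_≡_; _≢_)
open import Data.Product using (Σ; _×_)
open import Relation.Nullary using (¬_)

Σ[_] : ∀ {n} → (Fin n → ℕ) → ℕ
Σ[ f ] = sum (tabulate f)

-- A finite loopless (multi)graph on vertex set Fin n:
-- mult u v = number of edges joining u and v.
record Graph : Set where
  field
    n        : ℕ
    mult     : Fin n → Fin n → ℕ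
    symm     : ∀ u v → mult u v ≡ mult v u
    loopless : ∀ v → mult v v ≡ 0

module _ (G : Graph) where
  open Graph G

  Adj : Fin n → Fin n → Set
  Adj u v = 1 ≤ mult u v

  deg : Fin n → ℕ
  deg v = Σ[ (λ u → mult v u) ]

  IsClique : (s : ℕ) → (Fin s → Fin n) → Set
  IsClique s c = ∀ a b → a ≢ b → Adj (c a) (c b)

  Coloring : ℕ → Set
  Coloring k = Fin n → Fin k

  -- f_i(ψ): number of edges both of whose endpoints have color i
  -- (each unordered pair {u,v}, u < v, counted with its multiplicity)
  monoEdges : ∀ {k} → Coloring k → Fin k → ℕ
  monoEdges ψ i = Σ[ (λ u → Σ[ (λ v →
    if ⌊ u <? v ⌋ ∧ ⌊ ψ u ≟ i ⌋ ∧ ⌊ ψ v ≟ i ⌋ then mult u v else 0) ]) ]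

-- f / a as a rational (a ≥ 2 in all uses; the zero case is never used)
frac : ℕ → ℕ → ℚ
frac f zero    = 0ℚ
frac f (suc a) = (+ f) / suc a

sumℚ : ∀ {k} → (Fin k → ℚ) → ℚ
sumℚ {zero}  f = 0ℚ
sumℚ {suc k} f = f Fin.zero ℚ.+ sumℚ (λ i → f (Fin.suc i))
  where import Data.Fin as Fin

Φ : (G : Graph) → ∀ {k} → (α : Fin k → ℕ) → Coloring G k → ℚ
Φ G α ψ = sumℚ (λ i → frac (monoEdges G ψ i) (α i))

module Submission where

-- Put W_i = Π_{j ≠ i} α_j and F(ψ) = Σ_u W_{ψ u} · d_{ψ u}(u), where d_c(u) is the number of
-- edges from u into the colour class c.  Then F = 2 · Π α · Φ, so F-minimal colourings are
-- Φ-minimal.  Recolouring a single vertex v from c to l changes F by 2 (W_l d_l(v) − W_c d_c(v)),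
-- so in an F-minimal colouring d_c(v) ≤ α_c for the own colour c of every v, and d_c(v) = α_c
-- forces d_l(v) = α_l for every l, because Σ_l d_l(v) ≤ D = Σ_l α_l.
-- A vertex is bad if it lies in a monochromatic clique on α_c + 1 vertices.  A good colouring
-- minimises F and then the total weight P of its bad vertices (a bad vertex of colour c weighs
-- Π_{j ≠ c} (α_j + 1)).  In a good colouring a bad vertex can be recoloured to any other colour
-- so that the colouring stays good and the vertex stays bad.  Using such moves, a chain
-- argument shows that the clique of a bad vertex x has a shared neighbour of every other colour;
-- this forces the closed neighbourhood of x to be a clique on D + 1 vertices.  As every
-- monochromatic K_{α_i + 1} consists of bad vertices, any good colouring proves the theorem.

open import Defs
open import Level using (0ℓ)
open import Data.Nat using (ℕ; zero; suc; _+_; _*_; _∸_; _≤_; _<_; z≤n; s≤s; _≤?_; _≤ᵇ_; >-nonZero)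
open import Data.Nat.Properties hiding (_≟_; _<?_; _≤?_)
open import Data.Fin using (Fin; _≟_; _<?_; fromℕ<) renaming (zero to fz; suc to fs)
import Data.Fin.Properties as FinP
open import Data.Bool using (Bool; true; false; if_then_else_; _∧_; _∨_; not; T)
open import Data.Bool.Properties using (T-∧; T-∨; T-≡; ∧-identityʳ; ∧-zeroʳ)
open import Data.Unit using (tt)
open import Data.Empty using (⊥; ⊥-elim)
open import Data.Product using (Σ; ∃; _×_; _,_; proj₁; proj₂)
import Data.Product.Relation.Binary.Lex.NonStrict as Lex
open import Data.Sum using (_⊎_; inj₁; inj₂)
import Data.Integer as ℤ
import Data.Integer.Properties as ℤP
open import Data.Rational using (ℚ)
import Data.Rational as ℚ
import Data.Rational.Properties as ℚP
open import Data.Rational.Unnormalised using (ℚᵘ; mkℚᵘ)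
import Data.Rational.Unnormalised as ℚᵘ
import Data.Rational.Unnormalised.Properties as ℚᵘP
open import Function using (_∘_; Equivalence)
open import Function.Definitions using (Injective)
open import Relation.Nullary using (¬_)
open import Relation.Nullary.Decidable
  using (Dec; yes; no; does; ⌊_⌋; isYes≗does; dec-true; dec-false; toSum; T?; ¬?; _×-dec_; _→-dec_; toWitness; fromWitness)
open import Relation.Binary.PropositionalEquality
open import Relation.Binary.Bundles using (TotalPreorder; TotalOrder)
open import Relation.Binary.Definitions using (tri<; tri≈; tri>)
open import Algebra.Properties.Semiring.Sum +-*-semiring
  using (sum; sum-cong-≗; ∑-distrib-+; ∑-comm; *-distribˡ-sum; *-distribʳ-sum; sum-replicate-zero)

private variable n : ℕ

Σ≡sum : (f : Fin n → ℕ) → Σ[ f ] ≡ sum f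
Σ≡sum {zero}  f = refl
Σ≡sum {suc n} f = cong (f fz +_) (Σ≡sum (f ∘ fs))

sum-zero : (f : Fin n → ℕ) → (∀ i → f i ≡ 0) → sum f ≡ 0
sum-zero {n} f f≡0 = trans (sum-cong-≗ f≡0) (sum-replicate-zero n)

sum-mono : {f g : Fin n → ℕ} → (∀ i → f i ≤ g i) → sum f ≤ sum g
sum-mono {zero}  f≤g = z≤n
sum-mono {suc n} f≤g = +-mono-≤ (f≤g fz) (sum-mono (f≤g ∘ fs))

sum-mono-< : {f g : Fin n → ℕ} → (∀ i → f i ≤ g i) → (j : Fin n) → f j < g j → sum f < sum g
sum-mono-< {suc n} f≤g fz     fj<gj = +-mono-<-≤ fj<gj (sum-mono (f≤g ∘ fs))
sum-mono-< {suc n} f≤g (fs j) fj<gj = +-mono-≤-< (f≤g fz) (sum-mono-< (f≤g ∘ fs) j fj<gj)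

sum-tight : {f g : Fin n → ℕ} → (∀ i → f i ≤ g i) → sum g ≤ sum f → ∀ i → f i ≡ g i
sum-tight f≤g Σg≤Σf i with m≤n⇒m<n∨m≡n (f≤g i)
... | inj₂ fi≡gi = fi≡gi
... | inj₁ fi<gi = ⊥-elim (<⇒≱ (sum-mono-< f≤g i fi<gi) Σg≤Σf)

_==_ : Fin n → Fin n → Bool
i == j = does (i ≟ j)

==-refl : (i : Fin n) → (i == i) ≡ true
==-refl i = dec-true (i ≟ i) refl

==⇒≡ : {i j : Fin n} → (i == j) ≡ true → i ≡ j
==⇒≡ {i = i} {j} eq with i ≟ j
... | yes i≡j = i≡j

≢⇒==f : {i j : Fin n} → ¬ i ≡ j → (i == j) ≡ false
≢⇒==f {i = i} {j} = dec-false (i ≟ j)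

==-sym : (i j : Fin n) → (i == j) ≡ (j == i)
==-sym i j with i ≟ j | j ≟ i
... | yes _   | yes _   = refl
... | no  _   | no  _   = refl
... | yes i≡j | no  j≢i = ⊥-elim (j≢i (sym i≡j))
... | no  i≢j | yes j≡i = ⊥-elim (i≢j (sym j≡i))

T-∧⁻ : ∀ {a b} → T (a ∧ b) → T a × T b
T-∧⁻ = Equivalence.to T-∧

T-∧⁺ : ∀ {a b} → T a → T b → T (a ∧ b)
T-∧⁺ ta tb = Equivalence.from T-∧ (ta , tb)

T-∨⁻ : ∀ {a b} → T (a ∨ b) → T a ⊎ T b
T-∨⁻ = Equivalence.to T-∨

T-∨⁺ : ∀ {a b} → T a ⊎ T b → T (a ∨ b)
T-∨⁺ = Equivalence.from T-∨

T⇒≡true : ∀ {a} → T a → a ≡ true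
T⇒≡true = Equivalence.to T-≡

≡true⇒T : ∀ {a} → a ≡ true → T a
≡true⇒T = Equivalence.from T-≡

⌊⌋-⇔ : ∀ {a b} {A : Set a} {B : Set b} → (A → B) → (B → A) → (a? : Dec A) (b? : Dec B) → ⌊ a? ⌋ ≡ ⌊ b? ⌋
⌊⌋-⇔ A⇒B B⇒A (yes a) (yes b) = refl
⌊⌋-⇔ A⇒B B⇒A (no ¬a) (no ¬b) = refl
⌊⌋-⇔ A⇒B B⇒A (yes a) (no ¬b) = ⊥-elim (¬b (A⇒B a))
⌊⌋-⇔ A⇒B B⇒A (no ¬a) (yes b) = ⊥-elim (¬a (B⇒A b))

point : Fin n → ℕ → Fin n → ℕ
point j c i = if i == j then c else 0

point-self : (j : Fin n) (c : ℕ) → point j c j ≡ c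
point-self j c rewrite ==-refl j = refl

point-other : {i j : Fin n} (c : ℕ) → ¬ i ≡ j → point j c i ≡ 0
point-other c i≢j rewrite ≢⇒==f i≢j = refl

sum-point : (j : Fin n) (c : ℕ) → sum (point j c) ≡ c
sum-point {suc n} fz     c = trans (cong (c +_) (sum-zero {n} _ (λ _ → refl))) (+-identityʳ c)
sum-point {suc n} (fs j) c = sum-point j c

sum-partition : ∀ {k} (ψ : Fin n → Fin k) (g : Fin n → ℕ) →
  sum g ≡ sum (λ c → sum (λ u → if ψ u == c then g u else 0))
sum-partition {n} {k} ψ g = trans (sum-cong-≗ (λ u → sym (trans (sum-cong-≗ (class u)) (sum-point (ψ u) (g u)))))
                                  (∑-comm (λ u c → if ψ u == c then g u else 0))
  where
  class : ∀ u c → (if ψ u == c then g u else 0) ≡ point (ψ u) (g u) c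
  class u c rewrite ==-sym (ψ u) c = refl

sum-update : (x : Fin n) (f f' : Fin n → ℕ) (e e' : ℕ) →
  (∀ u → f' u + point x e u ≡ f u + point x e' u) → sum f' + e ≡ sum f + e'
sum-update x f f' e e' pointwise = begin
  sum f' + e                            ≡⟨ cong (sum f' +_) (sum-point x e) ⟨
  sum f' + sum (point x e)              ≡⟨ ∑-distrib-+ f' (point x e) ⟨
  sum (λ u → f' u + point x e u)        ≡⟨ sum-cong-≗ pointwise ⟩
  sum (λ u → f u + point x e' u)        ≡⟨ ∑-distrib-+ f (point x e') ⟩
  sum f + sum (point x e')              ≡⟨ cong (sum f +_) (sum-point x e') ⟩
  sum f + e'                            ∎
  where open ≡-Reasoning

ind : Bool → ℕ
ind true  = 1
ind false = 0

ind-∧ : (b c : Bool) → ind (b ∧ c) ≡ (if b then ind c else 0)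
ind-∧ true  c = refl
ind-∧ false c = refl

count : (Fin n → Bool) → ℕ
count P = sum (λ i → ind (P i))

sum-indicator : (P : Fin n → Bool) (m : ℕ) → sum (λ u → if P u then m else 0) ≡ m * count P
sum-indicator P m = trans (sum-cong-≗ (scaled ∘ P)) (sym (*-distribˡ-sum m (λ u → ind (P u))))
  where
  scaled : ∀ b → (if b then m else 0) ≡ m * ind b
  scaled true  = sym (*-identityʳ m)
  scaled false = sym (*-zeroʳ m)

count-cong : {P Q : Fin n → Bool} → (∀ i → P i ≡ Q i) → count P ≡ count Q
count-cong P≡Q = sum-cong-≗ (cong ind ∘ P≡Q)

count-≤ : (P : Fin n → Bool) → count P ≤ n
count-≤ {zero}  P = z≤n
count-≤ {suc n} P with P fz
... | true  = s≤s (count-≤ (P ∘ fs))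
... | false = m≤n⇒m≤1+n (count-≤ (P ∘ fs))

private
  ind-mono : {a b : Bool} → (T a → T b) → ind a ≤ ind b
  ind-mono {false}         a⇒b = z≤n
  ind-mono {true}  {true}  a⇒b = ≤-refl
  ind-mono {true}  {false} a⇒b = ⊥-elim (a⇒b tt)

  ind-< : {a b : Bool} → T b → ¬ T a → ind a < ind b
  ind-< {false} {true} _ _  = s≤s z≤n
  ind-< {true}         _ ¬a = ⊥-elim (¬a tt)

count-mono : {P Q : Fin n → Bool} → (∀ i → T (P i) → T (Q i)) → count P ≤ count Q
count-mono P⊆Q = sum-mono (λ i → ind-mono (P⊆Q i))

count-strict : {P Q : Fin n → Bool} → (∀ i → T (P i) → T (Q i)) →
  (j : Fin n) → T (Q j) → ¬ T (P j) → count P < count Q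
count-strict P⊆Q j Qj ¬Pj = sum-mono-< (λ i → ind-mono (P⊆Q i)) j (ind-< Qj ¬Pj)

count-tight : {P Q : Fin n → Bool} → (∀ i → T (P i) → T (Q i)) → count Q ≤ count P →
  ∀ i → T (Q i) → T (P i)
count-tight {P = P} P⊆Q #Q≤#P i Qi with P i in Pi
... | true  = tt
... | false = ⊥-elim (<⇒≱ (count-strict P⊆Q i Qi (subst T Pi)) #Q≤#P)

count-witness : (P : Fin n → Bool) → 0 < count P → Σ (Fin n) (λ i → T (P i))
count-witness {suc n} P 0<#P with P fz in P0
... | true  = fz , subst T (sym P0) tt
... | false with count-witness (P ∘ fs) 0<#P
...   | i , Pi = fs i , Pi

count-remove : (P : Fin n → Bool) (v : Fin n) → T (P v) →
  count P ≡ suc (count (λ i → P i ∧ not (i == v)))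
count-remove {suc n} P fz     Pv with P fz
... | true  = cong suc (count-cong (λ i → sym (∧-identityʳ (P (fs i)))))
count-remove {suc n} P (fs v) Pv with P fz
... | true  = cong suc (count-remove (P ∘ fs) v Pv)
... | false = count-remove (P ∘ fs) v Pv

count-insert : (P : Fin n → Bool) (y : Fin n) → ¬ T (P y) →
  count (λ u → (u == y) ∨ P u) ≡ suc (count P)
count-insert {suc n} P fz     ¬Py with P fz
... | true  = ⊥-elim (¬Py tt)
... | false = refl
count-insert {suc n} P (fs y) ¬Py =
  trans (cong (ind (P fz) +_) (count-insert (P ∘ fs) y ¬Py)) (+-suc (ind (P fz)) (count (P ∘ fs)))

≢⇒T≠ : {i j : Fin n} → ¬ i ≡ j → T (not (i == j))
≢⇒T≠ i≢j = subst (T ∘ not) (sym (≢⇒==f i≢j)) tt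

T≠⇒≢ : {i j : Fin n} → T (not (i == j)) → ¬ i ≡ j
T≠⇒≢ {i = i} i≠j refl = subst (T ∘ not) (==-refl i) i≠j

count-injection : ∀ {m} (P : Fin n → Bool) (f : Fin m → Fin n) → Injective _≡_ _≡_ f →
  (∀ a → T (P (f a))) → m ≤ count P
count-injection {m = zero}  P f f-inj Pf = z≤n
count-injection {m = suc m} P f f-inj Pf rewrite count-remove P (f fz) (Pf fz) =
  s≤s (count-injection (λ i → P i ∧ not (i == f fz)) (f ∘ fs) (FinP.suc-injective ∘ f-inj) Pf-rest)
  where
  Pf-rest : ∀ a → T (P (f (fs a)) ∧ not (f (fs a) == f fz))
  Pf-rest a = T-∧⁺ (Pf (fs a)) (≢⇒T≠ (λ eq → FinP.0≢1+n (sym (f-inj eq))))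

count-enumerate : ∀ {m} (P : Fin n → Bool) → m ≤ count P →
  Σ (Fin m → Fin n) (λ f → Injective _≡_ _≡_ f × (∀ a → T (P (f a))))
count-enumerate {m = zero}  P m≤#P = (λ ()) , (λ {}) , (λ ())
count-enumerate {m = suc m} P m≤#P with count-witness P (≤-trans (s≤s z≤n) m≤#P)
... | v , Pv with count-enumerate {m = m} (λ i → P i ∧ not (i == v))
                    (≤-pred (subst (suc m ≤_) (count-remove P v Pv) m≤#P))
... | g , g-inj , Pg = f , f-inj , Pf
  where
  g≢v : ∀ a → ¬ g a ≡ v
  g≢v a = T≠⇒≢ (proj₂ (T-∧⁻ (Pg a)))
  f : Fin (suc m) → Fin _
  f fz     = v
  f (fs a) = g a
  f-inj : Injective _≡_ _≡_ f
  f-inj {fz}   {fz}   _  = refl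
  f-inj {fz}   {fs b} eq = ⊥-elim (g≢v b (sym eq))
  f-inj {fs a} {fz}   eq = ⊥-elim (g≢v a eq)
  f-inj {fs a} {fs b} eq = cong fs (g-inj eq)
  Pf : ∀ a → T (P (f a))
  Pf fz     = Pv
  Pf (fs a) = proj₁ (T-∧⁻ (Pg a))

prod : ∀ {k} → (Fin k → ℕ) → ℕ
prod {zero}  g = 1
prod {suc k} g = g fz * prod (g ∘ fs)

prodExcept : ∀ {k} → (Fin k → ℕ) → Fin k → ℕ
prodExcept {suc k} g fz     = prod (g ∘ fs)
prodExcept {suc k} g (fs i) = g fz * prodExcept (g ∘ fs) i

prodExcept-spec : ∀ {k} (g : Fin k → ℕ) (i : Fin k) → g i * prodExcept g i ≡ prod g
prodExcept-spec {suc k} g fz     = refl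
prodExcept-spec {suc k} g (fs i) = begin
  g (fs i) * (g fz * prodExcept (g ∘ fs) i) ≡⟨ *-assoc (g (fs i)) (g fz) _ ⟨
  g (fs i) * g fz * prodExcept (g ∘ fs) i   ≡⟨ cong (_* prodExcept (g ∘ fs) i) (*-comm (g (fs i)) (g fz)) ⟩
  g fz * g (fs i) * prodExcept (g ∘ fs) i   ≡⟨ *-assoc (g fz) (g (fs i)) _ ⟩
  g fz * (g (fs i) * prodExcept (g ∘ fs) i) ≡⟨ cong (g fz *_) (prodExcept-spec (g ∘ fs) i) ⟩
  g fz * prod (g ∘ fs)                      ∎
  where open ≡-Reasoning

prod-pos : ∀ {k} (g : Fin k → ℕ) → (∀ i → 1 ≤ g i) → 1 ≤ prod g
prod-pos {zero}  g g-pos = s≤s z≤n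
prod-pos {suc k} g g-pos = *-mono-≤ (g-pos fz) (prod-pos (g ∘ fs) (g-pos ∘ fs))

prodExcept-pos : ∀ {k} (g : Fin k → ℕ) → (∀ i → 1 ≤ g i) → ∀ i → 1 ≤ prodExcept g i
prodExcept-pos {suc k} g g-pos fz     = prod-pos (g ∘ fs) (g-pos ∘ fs)
prodExcept-pos {suc k} g g-pos (fs i) = *-mono-≤ (g-pos fz) (prodExcept-pos (g ∘ fs) (g-pos ∘ fs) i)

-- Over the common denominator Π α, the rational Σ_i f_i / α_i has numerator
-- Σ_i f_i W_i; hence comparing such sums reduces to comparing natural numbers.
private
  ≃-from-parts : (p q : ℚᵘ) → ℚᵘ.↥ p ≡ ℚᵘ.↥ q → ℚᵘ.↧ p ≡ ℚᵘ.↧ q → p ℚᵘ.≃ q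
  ≃-from-parts p q ↥≡ ↧≡ = ℚᵘ.*≡* (cong₂ ℤ._*_ ↥≡ (sym ↧≡))

sumFrac-common : ∀ {k} (α : Fin k → ℕ) → (∀ i → 1 ≤ α i) → (f : Fin k → ℕ) →
  ℚ.toℚᵘ (sumℚ (λ i → frac (f i) (α i))) ℚᵘ.≃
    mkℚᵘ (ℤ.+ sum (λ i → f i * prodExcept α i)) (prod α ∸ 1)
sumFrac-common {zero}  α α-pos f = ℚᵘ.*≡* refl
sumFrac-common {suc k} α α-pos f with α fz | α-pos fz
... | suc a | _ = ℚᵘP.≃-trans (ℚP.toℚᵘ-homo-+ (frac (f fz) (suc a)) rest)
                    (ℚᵘP.≃-trans (ℚᵘP.+-cong head (sumFrac-common (α ∘ fs) (α-pos ∘ fs) (f ∘ fs)))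
                                 (≃-from-parts _ _ numerator denominator))
  where
  L R : ℕ
  L = prod (α ∘ fs)
  R = sum (λ i → f (fs i) * prodExcept (α ∘ fs) i)
  rest : ℚ
  rest = sumℚ (λ i → frac (f (fs i)) (α (fs i)))
  L≥1 : 1 ≤ L
  L≥1 = prod-pos (α ∘ fs) (α-pos ∘ fs)
  head : ℚ.toℚᵘ (frac (f fz) (suc a)) ℚᵘ.≃ mkℚᵘ (ℤ.+ f fz) a
  head = ℚP.toℚᵘ-fromℚᵘ (mkℚᵘ (ℤ.+ f fz) a)
  tail-sum : sum (λ i → f (fs i) * (suc a * prodExcept (α ∘ fs) i)) ≡ suc a * R
  tail-sum = trans (sum-cong-≗ (λ i → *-comm-middle (f (fs i)) (suc a) _)) (sym (*-distribˡ-sum (suc a) (λ i → f (fs i) * prodExcept (α ∘ fs) i)))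
    where
    *-comm-middle : ∀ x y z → x * (y * z) ≡ y * (x * z)
    *-comm-middle x y z = trans (sym (*-assoc x y z)) (trans (cong (_* z) (*-comm x y)) (*-assoc y x z))
  numerator : ℚᵘ.↥ (mkℚᵘ (ℤ.+ f fz) a ℚᵘ.+ mkℚᵘ (ℤ.+ R) (L ∸ 1))
            ≡ ℤ.+ (f fz * L + sum (λ i → f (fs i) * (suc a * prodExcept (α ∘ fs) i)))
  numerator = begin
    ℤ.+ f fz ℤ.* ℤ.+ suc (L ∸ 1) ℤ.+ ℤ.+ R ℤ.* ℤ.+ suc a ≡⟨ cong₂ ℤ._+_ (sym (ℤP.pos-* (f fz) (suc (L ∸ 1))))
                                                               (sym (ℤP.pos-* R (suc a))) ⟩
    ℤ.+ (f fz * suc (L ∸ 1)) ℤ.+ ℤ.+ (R * suc a)     ≡⟨ sym (ℤP.pos-+ (f fz * suc (L ∸ 1)) (R * suc a)) ⟩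
    ℤ.+ (f fz * suc (L ∸ 1) + R * suc a)           ≡⟨ cong ℤ.+_ (cong₂ _+_ (cong (f fz *_) (suc-pred L {{>-nonZero L≥1}}))
                                                       (trans (*-comm R (suc a)) (sym tail-sum))) ⟩
    ℤ.+ (f fz * L + sum (λ i → f (fs i) * (suc a * prodExcept (α ∘ fs) i))) ∎
    where open ≡-Reasoning
  denominator : ℚᵘ.↧ (mkℚᵘ (ℤ.+ f fz) a ℚᵘ.+ mkℚᵘ (ℤ.+ R) (L ∸ 1)) ≡ ℤ.+ suc (suc a * L ∸ 1)
  denominator = cong ℤ.+_ (trans (cong (suc a *_) (suc-pred L {{>-nonZero L≥1}}))
                               (sym (suc-pred (suc a * L) {{>-nonZero (*-mono-≤ {1} {suc a} (s≤s z≤n) L≥1)}})))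

sumFrac-mono : ∀ {k} (α : Fin k → ℕ) → (∀ i → 1 ≤ α i) → (f g : Fin k → ℕ) →
  sum (λ i → f i * prodExcept α i) ≤ sum (λ i → g i * prodExcept α i) →
  sumℚ (λ i → frac (f i) (α i)) ℚ.≤ sumℚ (λ i → frac (g i) (α i))
sumFrac-mono α α-pos f g Σf≤Σg =
  ℚP.toℚᵘ-cancel-≤ (ℚᵘP.≤-respˡ-≃ (ℚᵘP.≃-sym (sumFrac-common α α-pos f))
                    (ℚᵘP.≤-respʳ-≃ (ℚᵘP.≃-sym (sumFrac-common α α-pos g)) common))
  where
  d : ℕ
  d = prod α ∸ 1
  common : mkℚᵘ (ℤ.+ sum (λ i → f i * prodExcept α i)) d ℚᵘ.≤ mkℚᵘ (ℤ.+ sum (λ i → g i * prodExcept α i)) d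
  common = ℚᵘ.*≤* (subst₂ ℤ._≤_ (ℤP.pos-* (sum (λ i → f i * prodExcept α i)) (suc d)) (ℤP.pos-* (sum (λ i → g i * prodExcept α i)) (suc d)) (ℤ.+≤+ (*-monoˡ-≤ (suc d) Σf≤Σg)))

module ArgMin {c ℓ₁ ℓ₂} (O : TotalPreorder c ℓ₁ ℓ₂) where
  open TotalPreorder O using (Carrier; _≲_; total) renaming (refl to ≲-refl; trans to ≲-trans)

  argmin-Fin : ∀ {k} (g : Fin (suc k) → Carrier) → Σ (Fin (suc k)) (λ c → ∀ c' → g c ≲ g c')
  argmin-Fin {zero}  g = fz , λ { fz → ≲-refl }
  argmin-Fin {suc k} g with argmin-Fin (g ∘ fs)
  ... | c , c-min with total (g fz) (g (fs c))
  ...   | inj₁ g0≲gc = fz   , λ { fz → ≲-refl ; (fs c') → ≲-trans g0≲gc (c-min c') }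
  ...   | inj₂ gc≲g0 = fs c , λ { fz → gc≲g0  ; (fs c') → c-min c' }

  private
    _∷ᶠ_ : ∀ {m} {A : Set} → A → (Fin m → A) → Fin (suc m) → A
    (a ∷ᶠ f) fz     = a
    (a ∷ᶠ f) (fs i) = f i

  argmin-Fun : ∀ {k} (m : ℕ) (key : (Fin m → Fin (suc k)) → Carrier) →
    (∀ ψ φ → (∀ i → ψ i ≡ φ i) → key ψ ≡ key φ) →
    Σ (Fin m → Fin (suc k)) (λ ξ → ∀ ψ → key ξ ≲ key ψ)
  argmin-Fun zero key key-cong = (λ ()) , λ ψ → subst (key (λ ()) ≲_) (key-cong (λ ()) ψ (λ ())) ≲-refl
  argmin-Fun {k} (suc m) key key-cong = ξ , ξ-min
    where
    key-from : Fin (suc k) → (Fin m → Fin (suc k)) → Carrier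
    key-from c ψ = key (c ∷ᶠ ψ)
    best-from : ∀ c → Σ (Fin m → Fin (suc k)) (λ ξ → ∀ ψ → key-from c ξ ≲ key-from c ψ)
    best-from c = argmin-Fun m (key-from c)
                    (λ ψ φ ψ≗φ → key-cong (c ∷ᶠ ψ) (c ∷ᶠ φ) (λ { fz → refl ; (fs i) → ψ≗φ i }))
    best-c : Σ (Fin (suc k)) (λ c → ∀ c' → key-from c (proj₁ (best-from c)) ≲ key-from c' (proj₁ (best-from c')))
    best-c = argmin-Fin (λ c → key-from c (proj₁ (best-from c)))
    ξ : Fin (suc m) → Fin (suc k)
    ξ = proj₁ best-c ∷ᶠ proj₁ (best-from (proj₁ best-c))
    ξ-min : ∀ ψ → key ξ ≲ key ψ
    ξ-min ψ = subst (key ξ ≲_) (key-cong (ψ fz ∷ᶠ (ψ ∘ fs)) ψ (λ { fz → refl ; (fs i) → refl }))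
                (≲-trans (proj₂ best-c (ψ fz)) (proj₂ (best-from (ψ fz)) (ψ ∘ fs)))

  argmin-Fun⁺ : ∀ {k} → 1 ≤ k → (m : ℕ) (key : (Fin m → Fin k) → Carrier) →
    (∀ ψ φ → (∀ i → ψ i ≡ φ i) → key ψ ≡ key φ) →
    Σ (Fin m → Fin k) (λ ξ → ∀ ψ → key ξ ≲ key ψ)
  argmin-Fun⁺ {suc k} _ = argmin-Fun

lex : TotalPreorder 0ℓ 0ℓ 0ℓ
lex = TotalOrder.totalPreorder (Lex.×-totalOrder ≤-decTotalOrder ≤-totalOrder)

module Colourings (G : Graph) (k : ℕ) where
  open Graph G using (mult; symm; loopless)

  V : Set
  V = Fin (Graph.n G)

  Col : Set
  Col = Coloring G k

  recolour : Col → V → Fin k → Col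
  recolour ψ x l u = if u == x then l else ψ u

  recolour-self : (ψ : Col) (x : V) (l : Fin k) → recolour ψ x l x ≡ l
  recolour-self ψ x l rewrite ==-refl x = refl

  recolour-other : (ψ : Col) (x : V) (l : Fin k) (u : V) → ¬ u ≡ x → recolour ψ x l u ≡ ψ u
  recolour-other ψ x l u u≢x rewrite ≢⇒==f u≢x = refl

  classSum : Col → Fin k → (V → ℕ) → ℕ
  classSum ψ a g = sum (λ u → if ψ u == a then g u else 0)

  classSum-recolour : (ψ : Col) (x : V) (l a : Fin k) (g : V → ℕ) →
    classSum (recolour ψ x l) a g + (if ψ x == a then g x else 0)
    ≡ classSum ψ a g + (if l == a then g x else 0)
  classSum-recolour ψ x l a g = sum-update x _ _ _ _ pointwise
    where
    pointwise : ∀ u → (if recolour ψ x l u == a then g u else 0) + point x (if ψ x == a then g x else 0) u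
                    ≡ (if ψ u == a then g u else 0) + point x (if l == a then g x else 0) u
    pointwise u with u ≟ x
    ... | yes refl = +-comm (if l == a then g u else 0) (if ψ u == a then g u else 0)
    ... | no _     = refl

  degIn : Col → Fin k → V → ℕ
  degIn ψ c v = classSum ψ c (mult v)

  degIn-recolour : (ψ : Col) (x : V) (l a : Fin k) (y : V) →
    degIn (recolour ψ x l) a y + (if ψ x == a then mult y x else 0)
    ≡ degIn ψ a y + (if l == a then mult y x else 0)
  degIn-recolour ψ x l a y = classSum-recolour ψ x l a (mult y)

  -- As G is loopless, the colour degrees of x do not depend on the colour of x.
  degIn-recolour-self : (ψ : Col) (x : V) (l a : Fin k) → degIn (recolour ψ x l) a x ≡ degIn ψ a x
  degIn-recolour-self ψ x l a =
    +-cancelʳ-≡ _ _ _ (trans (degIn-recolour ψ x l a x) (cong (degIn ψ a x +_) (trans (no-loop l) (sym (no-loop (ψ x))))))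
    where
    no-loop : ∀ b → (if b == a then mult x x else 0) ≡ 0
    no-loop b with b == a
    ... | true  = loopless x
    ... | false = refl

  degIn-total : (ψ : Col) (v : V) → sum (λ c → degIn ψ c v) ≡ deg G v
  degIn-total ψ v = sym (trans (Σ≡sum (mult v)) (sum-partition ψ (mult v)))

  adj : V → V → Bool
  adj u v = 1 ≤ᵇ mult u v

  adj⇒Adj : {u v : V} → T (adj u v) → Adj G u v
  adj⇒Adj {u} {v} = ≤ᵇ⇒≤ 1 (mult u v)

  Adj⇒adj : {u v : V} → Adj G u v → T (adj u v)
  Adj⇒adj = ≤⇒≤ᵇ

  adj-sym : {u v : V} → T (adj u v) → T (adj v u)
  adj-sym {u} {v} = subst (λ m → T (1 ≤ᵇ m)) (symm u v)

  adj⇒≢ : {u v : V} → T (adj u v) → ¬ u ≡ v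
  adj⇒≢ {u} u~v refl = subst (λ m → T (1 ≤ᵇ m)) (loopless u) u~v

  nbr : Col → Fin k → V → V → Bool
  nbr ψ c v u = (ψ u == c) ∧ adj v u

  nbrCount : Col → Fin k → V → ℕ
  nbrCount ψ c v = count (nbr ψ c v)

  nbr-colour : {ψ : Col} {c : Fin k} {v u : V} → T (nbr ψ c v u) → ψ u ≡ c
  nbr-colour t = ==⇒≡ (T⇒≡true (proj₁ (T-∧⁻ t)))

  nbr-adj : {ψ : Col} {c : Fin k} {v u : V} → T (nbr ψ c v u) → T (adj v u)
  nbr-adj t = proj₂ (T-∧⁻ t)

  nbr-intro : {ψ : Col} {c : Fin k} {v u : V} → ψ u ≡ c → T (adj v u) → T (nbr ψ c v u)
  nbr-intro {ψ} {c} {v} {u} refl v~u = T-∧⁺ (≡true⇒T (==-refl (ψ u))) v~u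

  nbr-irrefl : (ψ : Col) (c : Fin k) (v : V) → ¬ T (nbr ψ c v v)
  nbr-irrefl ψ c v t = adj⇒≢ (nbr-adj {ψ} {c} t) refl

  -- Counting neighbours ignores edge multiplicities.
  nbrCount≤degIn : (ψ : Col) (c : Fin k) (v : V) → nbrCount ψ c v ≤ degIn ψ c v
  nbrCount≤degIn ψ c v = sum-mono pointwise
    where
    pointwise : ∀ u → ind (nbr ψ c v u) ≤ (if ψ u == c then mult v u else 0)
    pointwise u with ψ u == c
    ... | false = z≤n
    ... | true with mult v u
    ...   | zero  = z≤n
    ...   | suc _ = s≤s z≤n

  nbrCount-recolour : (ψ : Col) (x : V) (l a : Fin k) (y : V) →
    nbrCount (recolour ψ x l) a y + (if ψ x == a then ind (adj y x) else 0)
    ≡ nbrCount ψ a y + (if l == a then ind (adj y x) else 0)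
  nbrCount-recolour ψ x l a y =
    trans (cong (_+ _) (sum-cong-≗ (λ u → ind-∧ (recolour ψ x l u == a) (adj y u))))
          (trans (classSum-recolour ψ x l a (λ u → ind (adj y u)))
                 (cong (_+ _) (sym (sum-cong-≗ (λ u → ind-∧ (ψ u == a) (adj y u))))))

  Clique : Col → Fin k → V → Set
  Clique ψ c v = ∀ u w → T (nbr ψ c v u) → T (nbr ψ c v w) → ¬ u ≡ w → T (adj u w)

  clique-transfer : (φ : Col) (y x : V) (l : Fin k) (a : ℕ) → φ y ≡ l →
    a ≤ nbrCount φ l y → Clique φ l y → T (nbr φ l y x) → nbrCount φ l x ≤ a →
    (a ≤ nbrCount φ l x) × Clique φ l x × (∀ u → T (nbr φ l x u) → u ≡ y ⊎ (T (nbr φ l y u) × ¬ u ≡ x))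
  clique-transfer φ y x l a φy≡l a≤#y y-clique x∈y #x≤a = a≤#x , x-clique , x-nbrs
    where
    around : V → Bool
    around u = (u == y) ∨ (nbr φ l y u ∧ not (u == x))
    #around : count around ≡ nbrCount φ l y
    #around = trans (count-insert (λ u → nbr φ l y u ∧ not (u == x)) y (nbr-irrefl φ l y ∘ proj₁ ∘ T-∧⁻))
                    (sym (count-remove (nbr φ l y) x x∈y))
    around⊆ : ∀ u → T (around u) → T (nbr φ l x u)
    around⊆ u t with T-∨⁻ {u == y} t
    ... | inj₂ t' = nbr-intro {φ} (nbr-colour {φ} u∈y) (y-clique x u x∈y u∈y (λ x≡u → T≠⇒≢ u≠x (sym x≡u)))
      where
      u∈y : T (nbr φ l y u)
      u∈y = proj₁ (T-∧⁻ t')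
      u≠x : T (not (u == x))
      u≠x = proj₂ (T-∧⁻ t')
    ... | inj₁ u=y = subst (T ∘ nbr φ l x) (sym (==⇒≡ (T⇒≡true u=y))) (nbr-intro {φ} φy≡l (adj-sym (nbr-adj {φ} x∈y)))
    a≤#x : a ≤ nbrCount φ l x
    a≤#x = ≤-trans a≤#y (≤-trans (≤-reflexive (sym #around)) (count-mono around⊆))
    ⊆around : ∀ u → T (nbr φ l x u) → T (around u)
    ⊆around = count-tight around⊆ (≤-trans #x≤a (≤-trans a≤#y (≤-reflexive (sym #around))))
    x-nbrs : ∀ u → T (nbr φ l x u) → u ≡ y ⊎ (T (nbr φ l y u) × ¬ u ≡ x)
    x-nbrs u u∈x with T-∨⁻ {u == y} (⊆around u u∈x)
    ... | inj₂ t   = inj₂ (proj₁ (T-∧⁻ t) , T≠⇒≢ (proj₂ (T-∧⁻ t)))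
    ... | inj₁ u=y = inj₁ (==⇒≡ (T⇒≡true u=y))
    x-clique : Clique φ l x
    x-clique u w u∈x w∈x u≢w with x-nbrs u u∈x | x-nbrs w w∈x
    ... | inj₁ refl       | inj₁ refl       = ⊥-elim (u≢w refl)
    ... | inj₁ refl       | inj₂ (w∈y , _)  = nbr-adj {φ} w∈y
    ... | inj₂ (u∈y , _)  | inj₁ refl       = adj-sym (nbr-adj {φ} u∈y)
    ... | inj₂ (u∈y , _)  | inj₂ (w∈y , _)  = y-clique u w u∈y w∈y u≢w

  closedNbr : Col → Fin k → V → V → Bool
  closedNbr ψ c x u = (u == x) ∨ nbr ψ c x u

  closedNbr-count : ∀ ψ c x → count (closedNbr ψ c x) ≡ suc (nbrCount ψ c x)
  closedNbr-count ψ c x = count-insert (nbr ψ c x) x (nbr-irrefl ψ c x)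

  closedNbr-self : ∀ ψ c x → T (closedNbr ψ c x x)
  closedNbr-self ψ c x = T-∨⁺ (inj₁ (≡true⇒T (==-refl x)))

  closedNbr-nbr : ∀ {ψ c x u} → T (nbr ψ c x u) → T (closedNbr ψ c x u)
  closedNbr-nbr u∈x = T-∨⁺ (inj₂ u∈x)

  closedNbr-cases : ∀ {ψ c x u} → T (closedNbr ψ c x u) → u ≡ x ⊎ T (nbr ψ c x u)
  closedNbr-cases {u = u} t with T-∨⁻ {u == _} t
  ... | inj₁ u=x = inj₁ (==⇒≡ (T⇒≡true u=x))
  ... | inj₂ u∈x = inj₂ u∈x

-- The integer potential F, a positive multiple of Φ.
module Potential (G : Graph) {k : ℕ} (α : Fin k → ℕ) where
  open Graph G using (mult; symm; loopless)
  open Colourings G k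

  W : Fin k → ℕ
  W = prodExcept α

  ownTerm : Col → V → ℕ
  ownTerm ψ u = W (ψ u) * degIn ψ (ψ u) u

  F : Col → ℕ
  F ψ = sum (ownTerm ψ)

  private
    weighted-swap : (a b : Fin k) (m : ℕ) → W b * (if a == b then m else 0) ≡ W a * (if b == a then m else 0)
    weighted-swap a b m with a ≟ b | b ≟ a
    ... | yes refl | yes _   = refl
    ... | no _     | no _    = trans (*-zeroʳ (W b)) (sym (*-zeroʳ (W a)))
    ... | yes a≡b  | no b≢a  = ⊥-elim (b≢a (sym a≡b))
    ... | no a≢b   | yes b≡a = ⊥-elim (a≢b (sym b≡a))

  edgeWeight : Col → V → Fin k → V → ℕ
  edgeWeight ψ x a u = W a * (if ψ u == a then mult x u else 0)

  sum-edgeWeight : ∀ ψ x a → sum (edgeWeight ψ x a) ≡ W a * degIn ψ a x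
  sum-edgeWeight ψ x a = sym (*-distribˡ-sum (W a) (λ u → if ψ u == a then mult x u else 0))

  -- Pointwise effect of recolouring x from c = ψ x to l on the terms of F: away from x
  -- only the edge to x moves between class sums; at x the own term is replaced.
  ownTerm-recolour : ∀ ψ x l u →
    ownTerm (recolour ψ x l) u + edgeWeight ψ x (ψ x) u + point x (ownTerm ψ x) u
    ≡ ownTerm ψ u + edgeWeight ψ x l u + point x (ownTerm (recolour ψ x l) x) u
  ownTerm-recolour ψ x l u with toSum (u ≟ x)
  ... | inj₁ refl = begin
    ownTerm ψ' u + edgeWeight ψ u c u + point u (ownTerm ψ u) u
      ≡⟨ cong₂ (λ z w → ownTerm ψ' u + z + w) (no-loop (ψ u == c) (W c)) (point-self u _) ⟩
    ownTerm ψ' u + 0 + ownTerm ψ u  ≡⟨ cong (_+ ownTerm ψ u) (+-identityʳ _) ⟩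
    ownTerm ψ' u + ownTerm ψ u      ≡⟨ +-comm (ownTerm ψ' u) _ ⟩
    ownTerm ψ u + ownTerm ψ' u      ≡⟨ cong (_+ ownTerm ψ' u) (+-identityʳ _) ⟨
    ownTerm ψ u + 0 + ownTerm ψ' u
      ≡⟨ cong₂ (λ z w → ownTerm ψ u + z + w) (no-loop (ψ u == l) (W l)) (point-self u _) ⟨
    ownTerm ψ u + edgeWeight ψ u l u + point u (ownTerm ψ' u) u ∎
    where
    open ≡-Reasoning
    ψ' : Col
    ψ' = recolour ψ u l
    c : Fin k
    c = ψ u
    no-loop : ∀ (b : Bool) w → w * (if b then mult u u else 0) ≡ 0
    no-loop true  w rewrite loopless u = *-zeroʳ w
    no-loop false w = *-zeroʳ w
  ... | inj₂ u≢x rewrite recolour-other ψ x l u u≢x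
                       | point-other (ownTerm ψ x) u≢x | point-other (ownTerm (recolour ψ x l) x) u≢x = begin
    W a * degIn ψ' a u + edgeWeight ψ x c u + 0
      ≡⟨ +-identityʳ _ ⟩
    W a * degIn ψ' a u + edgeWeight ψ x c u
      ≡⟨ cong (W a * degIn ψ' a u +_) (trans (weighted-swap a c (mult x u)) (cong (λ m → W a * (if c == a then m else 0)) (symm x u))) ⟩
    W a * degIn ψ' a u + W a * (if c == a then mult u x else 0)
      ≡⟨ *-distribˡ-+ (W a) _ _ ⟨
    W a * (degIn ψ' a u + (if c == a then mult u x else 0))
      ≡⟨ cong (W a *_) (degIn-recolour ψ x l a u) ⟩
    W a * (degIn ψ a u + (if l == a then mult u x else 0))
      ≡⟨ *-distribˡ-+ (W a) _ _ ⟩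
    W a * degIn ψ a u + W a * (if l == a then mult u x else 0)
      ≡⟨ cong (W a * degIn ψ a u +_) (trans (cong (λ m → W a * (if l == a then m else 0)) (symm u x)) (weighted-swap l a (mult x u))) ⟩
    W a * degIn ψ a u + edgeWeight ψ x l u
      ≡⟨ +-identityʳ _ ⟨
    W a * degIn ψ a u + edgeWeight ψ x l u + 0 ∎
    where
    open ≡-Reasoning
    ψ' : Col
    ψ' = recolour ψ x l
    c : Fin k
    c = ψ x
    a : Fin k
    a = ψ u

  F-recolour : (ψ : Col) (x : V) (l : Fin k) →
    F (recolour ψ x l) + 2 * (W (ψ x) * degIn ψ (ψ x) x) ≡ F ψ + 2 * (W l * degIn ψ l x)
  F-recolour ψ x l = begin
    F ψ' + 2 * Lost                         ≡⟨ cong (F ψ' +_) (cong (Lost +_) (+-identityʳ Lost)) ⟩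
    F ψ' + (Lost + Lost)                    ≡⟨ cong (λ z → F ψ' + (z + Lost)) (sum-edgeWeight ψ x c) ⟨
    F ψ' + (sum (edgeWeight ψ x c) + ownTerm ψ x)
                                            ≡⟨ +-assoc (F ψ') _ _ ⟨
    F ψ' + sum (edgeWeight ψ x c) + ownTerm ψ x
                                            ≡⟨ cong (_+ ownTerm ψ x) (∑-distrib-+ (ownTerm ψ') (edgeWeight ψ x c)) ⟨
    sum (λ u → ownTerm ψ' u + edgeWeight ψ x c u) + ownTerm ψ x
                                            ≡⟨ sum-update x _ _ _ _ (ownTerm-recolour ψ x l) ⟩
    sum (λ u → ownTerm ψ u + edgeWeight ψ x l u) + ownTerm ψ' x
                                            ≡⟨ cong₂ _+_ (∑-distrib-+ (ownTerm ψ) (edgeWeight ψ x l)) own-after ⟩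
    F ψ + sum (edgeWeight ψ x l) + Gained   ≡⟨ +-assoc (F ψ) _ _ ⟩
    F ψ + (sum (edgeWeight ψ x l) + Gained) ≡⟨ cong (λ z → F ψ + (z + Gained)) (sum-edgeWeight ψ x l) ⟩
    F ψ + (Gained + Gained)                 ≡⟨ cong (F ψ +_) (cong (Gained +_) (+-identityʳ Gained)) ⟨
    F ψ + 2 * Gained                        ∎
    where
    open ≡-Reasoning
    ψ' : Col
    ψ' = recolour ψ x l
    c : Fin k
    c = ψ x
    Lost Gained : ℕ
    Lost   = W c * degIn ψ c x
    Gained = W l * degIn ψ l x
    own-after : ownTerm ψ' x ≡ Gained
    own-after rewrite recolour-self ψ x l = cong (W l *_) (degIn-recolour-self ψ x l l)

  monoMult : Col → Fin k → V → V → ℕ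
  monoMult ψ i u v = if (ψ u == i) ∧ (ψ v == i) then mult u v else 0

  private
    monoMult-sym : ∀ ψ i u v → monoMult ψ i u v ≡ monoMult ψ i v u
    monoMult-sym ψ i u v with ψ u == i | ψ v == i
    ... | true  | true  = symm u v
    ... | true  | false = refl
    ... | false | true  = refl
    ... | false | false = refl

    monoMult-loop : ∀ ψ i u → monoMult ψ i u u ≡ 0
    monoMult-loop ψ i u with (ψ u == i) ∧ (ψ u == i)
    ... | true  = loopless u
    ... | false = refl

    upper lower : Col → Fin k → V → V → ℕ
    upper ψ i u v = if ⌊ u <? v ⌋ then monoMult ψ i u v else 0
    lower ψ i u v = if ⌊ v <? u ⌋ then monoMult ψ i u v else 0

    monoMult-split : ∀ ψ i u v → monoMult ψ i u v ≡ upper ψ i u v + lower ψ i u v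
    monoMult-split ψ i u v with u <? v | v <? u
    ... | yes u<v | yes v<u = ⊥-elim (FinP.<-asym u<v v<u)
    ... | yes _   | no _    = sym (+-identityʳ _)
    ... | no _    | yes _   = refl
    ... | no u≮v  | no v≮u with FinP.<-cmp u v
    ...   | tri< u<v _ _ = ⊥-elim (u≮v u<v)
    ...   | tri> _ _ v<u = ⊥-elim (v≮u v<u)
    ...   | tri≈ _ refl _ = monoMult-loop ψ i u

  monoEdges-upper : ∀ ψ i → monoEdges G ψ i ≡ sum (λ u → sum (upper ψ i u))
  monoEdges-upper ψ i = trans (Σ≡sum {Graph.n G} _) (sum-cong-≗ (λ u → trans (Σ≡sum {Graph.n G} _) (sum-cong-≗ (same-summand u))))
    where
    same-summand : ∀ u v → (if ⌊ u <? v ⌋ ∧ ⌊ ψ u ≟ i ⌋ ∧ ⌊ ψ v ≟ i ⌋ then mult u v else 0) ≡ upper ψ i u v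
    same-summand u v rewrite isYes≗does (ψ u ≟ i) | isYes≗does (ψ v ≟ i) with ⌊ u <? v ⌋
    ... | true  = refl
    ... | false = refl

  monoMult-double : ∀ ψ i → sum (λ u → sum (monoMult ψ i u)) ≡ 2 * monoEdges G ψ i
  monoMult-double ψ i = begin
    sum (λ u → sum (monoMult ψ i u))
      ≡⟨ sum-cong-≗ (λ u → trans (sum-cong-≗ (monoMult-split ψ i u)) (∑-distrib-+ (upper ψ i u) (lower ψ i u))) ⟩
    sum (λ u → sum (upper ψ i u) + sum (lower ψ i u))
      ≡⟨ ∑-distrib-+ (λ u → sum (upper ψ i u)) (λ u → sum (lower ψ i u)) ⟩
    E + sum (λ u → sum (lower ψ i u))
      ≡⟨ cong (E +_) (∑-comm (lower ψ i)) ⟩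
    E + sum (λ v → sum (λ u → lower ψ i u v))
      ≡⟨ cong (E +_) (sum-cong-≗ (λ v → sum-cong-≗ (λ u → cong (if ⌊ v <? u ⌋ then_else 0) (monoMult-sym ψ i u v)))) ⟩
    E + E
      ≡⟨ cong₂ _+_ (monoEdges-upper ψ i) (monoEdges-upper ψ i) ⟨
    monoEdges G ψ i + monoEdges G ψ i
      ≡⟨ cong (monoEdges G ψ i +_) (+-identityʳ (monoEdges G ψ i)) ⟨
    2 * monoEdges G ψ i ∎
    where
    open ≡-Reasoning
    E : ℕ
    E = sum (λ u → sum (upper ψ i u))

  weighted-monoMult : ∀ ψ u v → sum (λ i → monoMult ψ i u v * W i) ≡ W (ψ u) * (if ψ v == ψ u then mult u v else 0)
  weighted-monoMult ψ u v = trans (sum-cong-≗ only-ψu) (sum-point (ψ u) _)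
    where
    only-ψu : ∀ i → monoMult ψ i u v * W i ≡ point (ψ u) (W (ψ u) * (if ψ v == ψ u then mult u v else 0)) i
    only-ψu i with ψ u ≟ i | i ≟ ψ u
    ... | yes refl | yes _ = *-comm _ (W i)
    ... | no _     | no _  = refl
    ... | yes ψu≡i | no i≢ψu = ⊥-elim (i≢ψu (sym ψu≡i))
    ... | no ψu≢i  | yes i≡ψu = ⊥-elim (ψu≢i (sym i≡ψu))

  -- F is twice the integer Σ_i f_i(ψ) W_i, which is Π α · Φ(ψ).
  F≡2N : ∀ ψ → F ψ ≡ 2 * sum (λ i → monoEdges G ψ i * W i)
  F≡2N ψ = begin
    F ψ ≡⟨ sum-cong-≗ (λ u → *-distribˡ-sum (W (ψ u)) (λ v → if ψ v == ψ u then mult u v else 0)) ⟩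
    sum (λ u → sum (λ v → W (ψ u) * (if ψ v == ψ u then mult u v else 0)))
      ≡⟨ sum-cong-≗ (λ u → sum-cong-≗ (λ v → weighted-monoMult ψ u v)) ⟨
    sum (λ u → sum (λ v → sum (λ i → monoMult ψ i u v * W i)))
      ≡⟨ sum-cong-≗ (λ u → ∑-comm (λ v i → monoMult ψ i u v * W i)) ⟩
    sum (λ u → sum (λ i → sum (λ v → monoMult ψ i u v * W i)))
      ≡⟨ ∑-comm (λ u i → sum (λ v → monoMult ψ i u v * W i)) ⟩
    sum (λ i → sum (λ u → sum (λ v → monoMult ψ i u v * W i)))
      ≡⟨ sum-cong-≗ (λ i → trans (sum-cong-≗ (λ u → sym (*-distribʳ-sum (W i) (monoMult ψ i u))))
                                  (sym (*-distribʳ-sum (W i) (λ u → sum (monoMult ψ i u))))) ⟩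
    sum (λ i → sum (λ u → sum (monoMult ψ i u)) * W i)
      ≡⟨ sum-cong-≗ (λ i → trans (cong (_* W i) (monoMult-double ψ i)) (*-assoc 2 (monoEdges G ψ i) (W i))) ⟩
    sum (λ i → 2 * (monoEdges G ψ i * W i))
      ≡⟨ *-distribˡ-sum 2 (λ i → monoEdges G ψ i * W i) ⟨
    2 * sum (λ i → monoEdges G ψ i * W i) ∎
    where open ≡-Reasoning

  Φ-mono : (∀ i → 1 ≤ α i) → ∀ ξ ψ → F ξ ≤ F ψ → Φ G α ξ ℚ.≤ Φ G α ψ
  Φ-mono α-pos ξ ψ Fξ≤Fψ = sumFrac-mono α α-pos (monoEdges G ξ) (monoEdges G ψ)
    (*-cancelˡ-≤ 2 (subst₂ _≤_ (F≡2N ξ) (F≡2N ψ) Fξ≤Fψ))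

  -- F respects pointwise equality of colourings (there is no function extensionality).
  F-cong : ∀ ψ φ → (∀ u → ψ u ≡ φ u) → F ψ ≡ F φ
  F-cong ψ φ ψ≗φ = sum-cong-≗ (λ u → cong₂ (λ a b → W a * b) (ψ≗φ u)
                     (trans (same-degIn (ψ u)) (cong (λ c → degIn φ c u) (ψ≗φ u))))
    where
    same-degIn : ∀ c {u} → degIn ψ c u ≡ degIn φ c u
    same-degIn c {u} = sum-cong-≗ (λ u' → cong (λ z → if z == c then mult u u' else 0) (ψ≗φ u'))

module Optimal (G : Graph) {k : ℕ} (α : Fin k → ℕ) (α≥2 : ∀ i → 2 ≤ α i)
               (D : ℕ) (D≡Σα : D ≡ Σ[ α ]) (Δ≤D : ∀ v → deg G v ≤ D) where
  open Graph G using (mult; loopless)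
  open Colourings G k
  open Potential G α

  α-pos : ∀ i → 1 ≤ α i
  α-pos i = ≤-trans (s≤s z≤n) (α≥2 i)

  Wα-const : ∀ i j → W i * α i ≡ W j * α j
  Wα-const i j = trans (*-comm (W i) (α i))
                  (trans (prodExcept-spec α i) (trans (sym (prodExcept-spec α j)) (*-comm (α j) (W j))))

  FMin : Col → Set
  FMin ψ = ∀ ψ' → F ψ ≤ F ψ'

  locally-optimal : ∀ ψ → FMin ψ → ∀ v l → W (ψ v) * degIn ψ (ψ v) v ≤ W l * degIn ψ l v
  locally-optimal ψ ψ-min v l = *-cancelˡ-≤ 2 (+-cancelˡ-≤ (F ψ) _ _
    (≤-trans (+-monoˡ-≤ _ (ψ-min (recolour ψ v l))) (≤-reflexive (F-recolour ψ v l))))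

  module _ (ψ : Col) (ψ-min : FMin ψ) (v : V) (l : Fin k) where
    private
      c : Fin k
      c = ψ v
      instance _ = >-nonZero (prodExcept-pos α α-pos l)

    bound-spreads : α c ≤ degIn ψ c v → α l ≤ degIn ψ l v
    bound-spreads α≤d = *-cancelˡ-≤ (W l) (begin
      W l * α l          ≡⟨ Wα-const l c ⟩
      W c * α c          ≤⟨ *-monoʳ-≤ (W c) α≤d ⟩
      W c * degIn ψ c v  ≤⟨ locally-optimal ψ ψ-min v l ⟩
      W l * degIn ψ l v  ∎)
      where open ≤-Reasoning

    strict-bound-spreads : α c < degIn ψ c v → α l < degIn ψ l v
    strict-bound-spreads α<d = *-cancelˡ-< (W l) _ _ (begin-strict
      W l * α l          ≡⟨ Wα-const l c ⟩
      W c * α c          <⟨ *-monoʳ-< (W c) {{>-nonZero (prodExcept-pos α α-pos c)}} α<d ⟩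
      W c * degIn ψ c v  ≤⟨ locally-optimal ψ ψ-min v l ⟩
      W l * degIn ψ l v  ∎)
      where open ≤-Reasoning

  degIn-sum-≤ : ∀ ψ v → sum (λ c → degIn ψ c v) ≤ sum α
  degIn-sum-≤ ψ v = ≤-trans (≤-reflexive (degIn-total ψ v)) (≤-trans (Δ≤D v) (≤-reflexive (trans D≡Σα (Σ≡sum α))))

  -- Since Σ_l d_l(v) ≤ D = Σ_l α_l, a vertex has at most α_c edges into its own class c ...
  own-degIn-≤ : ∀ ψ → FMin ψ → ∀ v → degIn ψ (ψ v) v ≤ α (ψ v)
  own-degIn-≤ ψ ψ-min v with degIn ψ (ψ v) v ≤? α (ψ v)
  ... | yes d≤α = d≤α
  ... | no  d≰α = ⊥-elim (<⇒≱ (sum-mono-< (λ l → <⇒≤ (above l)) (ψ v) (above (ψ v))) (degIn-sum-≤ ψ v))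
    where
    above : ∀ l → α l < degIn ψ l v
    above l = strict-bound-spreads ψ ψ-min v l (≰⇒> d≰α)

  tight-everywhere : ∀ ψ → FMin ψ → ∀ v → degIn ψ (ψ v) v ≡ α (ψ v) → ∀ l → degIn ψ l v ≡ α l
  tight-everywhere ψ ψ-min v d≡α l =
    sym (sum-tight (λ l → bound-spreads ψ ψ-min v l (≤-reflexive (sym d≡α))) (degIn-sum-≤ ψ v) l)

  -- A vertex is bad if it and its neighbours of its own colour form a
  -- monochromatic clique on at least α_c + 1 vertices.
  Bad : Col → V → Set
  Bad ψ v = α (ψ v) ≤ nbrCount ψ (ψ v) v × Clique ψ (ψ v) v

  clique? : ∀ ψ c v → Dec (Clique ψ c v)
  clique? ψ c v = FinP.all? λ u → FinP.all? λ w →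
    T? (nbr ψ c v u) →-dec (T? (nbr ψ c v w) →-dec (¬? (u ≟ w) →-dec T? (adj u w)))

  bad? : ∀ ψ v → Dec (Bad ψ v)
  bad? ψ v = (α (ψ v) ≤? nbrCount ψ (ψ v) v) ×-dec clique? ψ (ψ v) v

  isBad : Col → V → Bool
  isBad ψ v = ⌊ bad? ψ v ⌋

  isBad⇒Bad : ∀ ψ v → T (isBad ψ v) → Bad ψ v
  isBad⇒Bad ψ v = toWitness

  Bad⇒isBad : ∀ ψ v → Bad ψ v → T (isBad ψ v)
  Bad⇒isBad ψ v = fromWitness

  Bad-transport : (φ φ' : Col) (y : V) → φ' y ≡ φ y →
    (∀ u → nbr φ' (φ y) y u ≡ nbr φ (φ y) y u) → Bad φ' y → Bad φ y
  Bad-transport φ φ' y φ'y≡φy same-nbrs rewrite φ'y≡φy = λ where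
    (α≤# , clique) → ≤-trans α≤# (≤-reflexive (count-cong same-nbrs)) ,
                     λ u w u∈ w∈ → clique u w (subst T (sym (same-nbrs u)) u∈) (subst T (sym (same-nbrs w)) w∈)

  isBad-cong : (φ φ' : Col) (y : V) → φ' y ≡ φ y →
    (∀ u → nbr φ' (φ y) y u ≡ nbr φ (φ y) y u) → isBad φ' y ≡ isBad φ y
  isBad-cong φ φ' y φ'y≡φy same-nbrs =
    ⌊⌋-⇔ (Bad-transport φ φ' y φ'y≡φy same-nbrs)
         (Bad-transport φ' φ y (sym φ'y≡φy) (λ u → subst (λ c → nbr φ c y u ≡ nbr φ' c y u) (sym φ'y≡φy) (sym (same-nbrs u))))
         (bad? φ' y) (bad? φ y)

  -- The secondary potential: each bad vertex of colour c weighs M_c = Π_{j ≠ c} (α_j + 1),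
  -- so that a bad clique on α_c + 1 vertices weighs Π (α + 1) whatever its colour.
  M : Fin k → ℕ
  M = prodExcept (suc ∘ α)

  badWeight : Col → V → ℕ
  badWeight ψ v = if isBad ψ v then M (ψ v) else 0

  P : Col → ℕ
  P ψ = sum (badWeight ψ)

  Good : Col → Set
  Good ψ = ∀ ψ' → F ψ < F ψ' ⊎ (F ψ ≡ F ψ' × P ψ ≤ P ψ')

  Good⇒FMin : ∀ ψ → Good ψ → FMin ψ
  Good⇒FMin ψ good ψ' with good ψ'
  ... | inj₁ F< = <⇒≤ F<
  ... | inj₂ (F≡ , _) = ≤-reflexive F≡

  Good-P : ∀ ψ → Good ψ → ∀ ψ' → F ψ' ≡ F ψ → P ψ ≤ P ψ'
  Good-P ψ good ψ' F≡ with good ψ'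
  ... | inj₁ F< = ⊥-elim (<⇒≢ F< (sym F≡))
  ... | inj₂ (_ , P≤) = P≤

  Good-transfer : ∀ ψ → Good ψ → ∀ ψ' → F ψ' ≡ F ψ → P ψ' ≡ P ψ → Good ψ'
  Good-transfer ψ good ψ' F≡ P≡ φ with good φ
  ... | inj₁ F<        = inj₁ (subst (_< F φ) (sym F≡) F<)
  ... | inj₂ (F≡' , P≤) = inj₂ (trans F≡ F≡' , subst (_≤ P φ) (sym P≡) P≤)

  bad-at : ∀ ψ v {j} → ψ v ≡ j → Bad ψ v → α j ≤ nbrCount ψ j v × Clique ψ j v
  bad-at ψ v refl v-bad = v-bad

  at-bad : ∀ ψ v {j} → ψ v ≡ j → α j ≤ nbrCount ψ j v × Clique ψ j v → Bad ψ v
  at-bad ψ v refl v-bad = v-bad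

  bad-transfer : ∀ φ y x → Bad φ y → T (nbr φ (φ y) y x) → nbrCount φ (φ y) x ≤ α (φ y) → Bad φ x
  bad-transfer φ y x (α≤# , y-clique) x∈y #x≤α
    with clique-transfer φ y x (φ y) (α (φ y)) refl α≤# y-clique x∈y #x≤α
  ... | α≤#x , x-clique , _ = at-bad φ x (nbr-colour {φ} x∈y) (α≤#x , x-clique)

  M-pos : ∀ j → 1 ≤ M j
  M-pos = prodExcept-pos (suc ∘ α) (λ _ → s≤s z≤n)

  badWeight-mono : ∀ φ φ' y → φ' y ≡ φ y → (T (isBad φ' y) → T (isBad φ y)) → badWeight φ' y ≤ badWeight φ y
  badWeight-mono φ φ' y same-colour bad'⇒bad with isBad φ' y | isBad φ y
  ... | false | _     = z≤n
  ... | true  | true  rewrite same-colour = ≤-refl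
  ... | true  | false = ⊥-elim (bad'⇒bad tt)

  module _ (ψ : Col) (ψ-min : FMin ψ) where
    nbrCount-own-≤ : ∀ v → nbrCount ψ (ψ v) v ≤ α (ψ v)
    nbrCount-own-≤ v = ≤-trans (nbrCount≤degIn ψ (ψ v) v) (own-degIn-≤ ψ ψ-min v)

    bad-degIn : ∀ x → Bad ψ x → degIn ψ (ψ x) x ≡ α (ψ x)
    bad-degIn x (α≤# , _) = ≤-antisym (own-degIn-≤ ψ ψ-min x) (≤-trans α≤# (nbrCount≤degIn ψ (ψ x) x))

    bad-nbrCount : ∀ x → Bad ψ x → nbrCount ψ (ψ x) x ≡ α (ψ x)
    bad-nbrCount x (α≤# , _) = ≤-antisym (nbrCount-own-≤ x) α≤#

    bad-degIn-everywhere : ∀ x → Bad ψ x → ∀ l → degIn ψ l x ≡ α l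
    bad-degIn-everywhere x x-bad = tight-everywhere ψ ψ-min x (bad-degIn x x-bad)

    bad-spreads : ∀ x y → Bad ψ x → T (nbr ψ (ψ x) x y) →
      Bad ψ y × (∀ u → T (nbr ψ (ψ y) y u) → u ≡ x ⊎ (T (nbr ψ (ψ x) x u) × ¬ u ≡ y))
    bad-spreads x y (α≤# , x-clique) y∈x rewrite nbr-colour {ψ} y∈x
      with clique-transfer ψ x y (ψ x) (α (ψ x)) refl α≤# x-clique y∈x
             (subst (λ c → nbrCount ψ c y ≤ α c) (nbr-colour {ψ} y∈x) (nbrCount-own-≤ y))
    ... | α≤#y , y-clique , y-nbrs = (α≤#y , y-clique) , y-nbrs

  -- Recolouring a bad vertex x of a good colouring ψ to another colour l gives a good
  -- colouring in which x is bad again: the old clique of x is dissolved, and x forms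
  -- a new bad clique with its α_l neighbours of colour l.
  module RecolourBad (ψ : Col) (good : Good ψ) (x : V) (x-bad : Bad ψ x) (l : Fin k) (l≢c : ¬ l ≡ ψ x) where
    c : Fin k
    c = ψ x

    ψ' : Col
    ψ' = recolour ψ x l

    ψ-min : FMin ψ
    ψ-min = Good⇒FMin ψ good

    ψ'x : ψ' x ≡ l
    ψ'x = recolour-self ψ x l

    ψ'u : ∀ u → ¬ u ≡ x → ψ' u ≡ ψ u
    ψ'u = recolour-other ψ x l

    -- x has exactly α_c edges into class c and α_l into class l: F does not change.
    F-unchanged : F ψ' ≡ F ψ
    F-unchanged = +-cancelʳ-≡ _ (F ψ') (F ψ) (begin
      F ψ' + 2 * (W c * α c)             ≡⟨ cong (λ d → F ψ' + 2 * (W c * d)) (bad-degIn ψ ψ-min x x-bad) ⟨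
      F ψ' + 2 * (W c * degIn ψ c x)     ≡⟨ F-recolour ψ x l ⟩
      F ψ + 2 * (W l * degIn ψ l x)      ≡⟨ cong (λ d → F ψ + 2 * (W l * d)) (bad-degIn-everywhere ψ ψ-min x x-bad l) ⟩
      F ψ + 2 * (W l * α l)              ≡⟨ cong (λ z → F ψ + 2 * z) (Wα-const l c) ⟩
      F ψ + 2 * (W c * α c)              ∎)
      where open ≡-Reasoning

    ψ'-min : FMin ψ'
    ψ'-min φ = subst (_≤ F φ) (sym F-unchanged) (ψ-min φ)

    isBad-unaffected : ∀ y → ¬ y ≡ x → (adj y x ≡ false ⊎ (¬ ψ y ≡ c × ¬ ψ y ≡ l)) → isBad ψ' y ≡ isBad ψ y
    isBad-unaffected y y≢x far = isBad-cong ψ ψ' y (ψ'u y y≢x) same-nbrs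
      where
      at-x : (adj y x ≡ false ⊎ (¬ ψ y ≡ c × ¬ ψ y ≡ l)) → nbr ψ' (ψ y) y x ≡ nbr ψ (ψ y) y x
      at-x (inj₁ y≁x) rewrite y≁x = trans (∧-zeroʳ _) (sym (∧-zeroʳ _))
      at-x (inj₂ (ψy≢c , ψy≢l)) rewrite ψ'x | ≢⇒==f {i = l} (ψy≢l ∘ sym) | ≢⇒==f {i = c} (ψy≢c ∘ sym) = refl
      same-nbrs : ∀ u → nbr ψ' (ψ y) y u ≡ nbr ψ (ψ y) y u
      same-nbrs u with toSum (u ≟ x)
      ... | inj₁ refl = at-x far
      ... | inj₂ u≢x  = cong (λ z → (z == ψ y) ∧ adj y u) (ψ'u u u≢x)

    -- The neighbours of x of colour l are unaffected (x is not its own neighbour).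
    x-nbrCount-l : nbrCount ψ' l x ≡ nbrCount ψ l x
    x-nbrCount-l = count-cong same
      where
      same : ∀ u → nbr ψ' l x u ≡ nbr ψ l x u
      same u with toSum (u ≟ x)
      ... | inj₁ refl rewrite loopless u = trans (∧-zeroʳ _) (sym (∧-zeroʳ _))
      ... | inj₂ u≢x = cong (λ z → (z == l) ∧ adj x u) (ψ'u u u≢x)

    x-nbrCount-l-≤ : nbrCount ψ' l x ≤ α l
    x-nbrCount-l-≤ = ≤-trans (nbrCount≤degIn ψ' l x)
                       (≤-reflexive (trans (degIn-recolour-self ψ x l l) (bad-degIn-everywhere ψ ψ-min x x-bad l)))

    bad-nbr-makes-bad : ∀ y → ψ y ≡ l → ¬ y ≡ x → T (adj y x) → Bad ψ' y → Bad ψ' x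
    bad-nbr-makes-bad y ψy≡l y≢x y~x y-bad' =
      bad-transfer ψ' y x y-bad' (nbr-intro {ψ'} (trans ψ'x (sym ψ'y≡l)) y~x)
                   (subst (λ j → nbrCount ψ' j x ≤ α j) (sym ψ'y≡l) x-nbrCount-l-≤)
      where
      ψ'y≡l : ψ' y ≡ l
      ψ'y≡l = trans (ψ'u y y≢x) ψy≡l

    -- x is bad in ψ': otherwise no vertex becomes bad and x stops being bad, so P drops.
    still-bad : Bad ψ' x
    still-bad with isBad ψ' x in x-status
    ... | true  = isBad⇒Bad ψ' x (subst T (sym x-status) tt)
    ... | false = ⊥-elim (<⇒≱ P-drops (Good-P ψ good ψ' F-unchanged))
      where
      no-new-bad : ∀ y → ¬ y ≡ x → T (isBad ψ' y) → T (isBad ψ y)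
      no-new-bad y y≢x y-bad' with adj y x in y~x
      ... | false = subst T (isBad-unaffected y y≢x (inj₁ y~x)) y-bad'
      ... | true with ψ y ≟ c
      ...   | yes ψy≡c = Bad⇒isBad ψ y (proj₁ (bad-spreads ψ ψ-min x y x-bad (nbr-intro {ψ} ψy≡c (adj-sym (≡true⇒T y~x)))))
      ...   | no ψy≢c with ψ y ≟ l
      ...     | yes ψy≡l = ⊥-elim (subst T x-status
                             (Bad⇒isBad ψ' x (bad-nbr-makes-bad y ψy≡l y≢x (≡true⇒T y~x) (isBad⇒Bad ψ' y y-bad'))))
      ...     | no ψy≢l  = subst T (isBad-unaffected y y≢x (inj₂ (ψy≢c , ψy≢l))) y-bad'
      pointwise : ∀ y → badWeight ψ' y ≤ badWeight ψ y
      pointwise y with toSum (y ≟ x)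
      ... | inj₁ refl rewrite x-status = z≤n
      ... | inj₂ y≢x  = badWeight-mono ψ ψ' y (ψ'u y y≢x) (no-new-bad y y≢x)
      x-drops : badWeight ψ' x < badWeight ψ x
      x-drops rewrite x-status | T⇒≡true (Bad⇒isBad ψ x x-bad) = M-pos c
      P-drops : P ψ' < P ψ
      P-drops = sum-mono-< pointwise x x-drops

    x-nbrCount-l-exact : nbrCount ψ l x ≡ α l
    x-nbrCount-l-exact = ≤-antisym (≤-trans (nbrCount≤degIn ψ l x) (≤-reflexive (bad-degIn-everywhere ψ ψ-min x x-bad l)))
                                   (≤-trans (proj₁ (bad-at ψ' x ψ'x still-bad)) (≤-reflexive x-nbrCount-l))

    cliqueWeight : Fin k → V → ℕ
    cliqueWeight j u = if closedNbr ψ j x u then M j else 0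

    cliqueWeight-total : ∀ j → nbrCount ψ j x ≡ α j → sum (cliqueWeight j) ≡ prod (suc ∘ α)
    cliqueWeight-total j #≡α = begin
      sum (cliqueWeight j)           ≡⟨ sum-indicator (closedNbr ψ j x) (M j) ⟩
      M j * count (closedNbr ψ j x)  ≡⟨ cong (M j *_) (trans (closedNbr-count ψ j x) (cong suc #≡α)) ⟩
      M j * suc (α j)                ≡⟨ *-comm (M j) (suc (α j)) ⟩
      suc (α j) * M j                ≡⟨ prodExcept-spec (suc ∘ α) j ⟩
      prod (suc ∘ α)                 ∎
      where open ≡-Reasoning

    -- The colour-c neighbours of x stop being bad: they lose the neighbour x.
    old-nbr-not-bad : ∀ u → ψ u ≡ c → T (adj u x) → ¬ Bad ψ' u
    old-nbr-not-bad u ψu≡c u~x u-bad' = <⇒≱ drops (proj₁ (bad-at ψ' u (trans (ψ'u u (adj⇒≢ u~x)) ψu≡c) u-bad'))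
      where
      loses-x : (if ψ x == c then ind (adj u x) else 0) ≡ 1
      loses-x rewrite ==-refl c | T⇒≡true u~x = refl
      gains-nothing : (if l == c then ind (adj u x) else 0) ≡ 0
      gains-nothing rewrite ≢⇒==f l≢c = refl
      moved : nbrCount ψ' c u + 1 ≡ nbrCount ψ c u + 0
      moved = subst₂ (λ a b → nbrCount ψ' c u + a ≡ nbrCount ψ c u + b) loses-x gains-nothing (nbrCount-recolour ψ x l c u)
      drops : nbrCount ψ' c u < α c
      drops = ≤-trans (≤-reflexive (trans (+-comm 1 _) (trans moved (+-identityʳ _))))
                      (subst (λ z → nbrCount ψ z u ≤ α z) ψu≡c (nbrCount-own-≤ ψ ψ-min u))

    -- The colour-l neighbours of x were not bad: in ψ' they have one more edge into class l.
    new-nbr-was-not-bad : ∀ u → ψ u ≡ l → T (adj u x) → ¬ Bad ψ u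
    new-nbr-was-not-bad u ψu≡l u~x u-bad = <⇒≱ below (proj₁ (bad-at ψ u ψu≡l u-bad))
      where
      ψ'u≡l : ψ' u ≡ l
      ψ'u≡l = trans (ψ'u u (adj⇒≢ u~x)) ψu≡l
      loses-nothing : (if ψ x == l then mult u x else 0) ≡ 0
      loses-nothing rewrite ≢⇒==f (l≢c ∘ sym) = refl
      gains-x : (if l == l then mult u x else 0) ≡ mult u x
      gains-x rewrite ==-refl l = refl
      moved : degIn ψ' l u + 0 ≡ degIn ψ l u + mult u x
      moved = subst₂ (λ a b → degIn ψ' l u + a ≡ degIn ψ l u + b) loses-nothing gains-x (degIn-recolour ψ x l l u)
      below : nbrCount ψ l u < α l
      below = begin-strict
        nbrCount ψ l u         ≤⟨ nbrCount≤degIn ψ l u ⟩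
        degIn ψ l u            <⟨ m<m+n (degIn ψ l u) (adj⇒Adj u~x) ⟩
        degIn ψ l u + mult u x ≡⟨ trans (sym moved) (+-identityʳ _) ⟩
        degIn ψ' l u           ≤⟨ subst (λ z → degIn ψ' z u ≤ α z) ψ'u≡l (own-degIn-≤ ψ' ψ'-min u) ⟩
        α l                    ∎
        where open ≤-Reasoning

    new-nbr-becomes-bad : ∀ u → ψ u ≡ l → T (adj u x) → Bad ψ' u
    new-nbr-becomes-bad u ψu≡l u~x =
      bad-transfer ψ' x u still-bad (nbr-intro {ψ'} ψ'u≡ψ'x (adj-sym u~x))
                   (subst (λ j → nbrCount ψ' j u ≤ α j) ψ'u≡ψ'x (nbrCount-own-≤ ψ' ψ'-min u))
      where
      ψ'u≡ψ'x : ψ' u ≡ ψ' x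
      ψ'u≡ψ'x = trans (trans (ψ'u u (adj⇒≢ u~x)) ψu≡l) (sym ψ'x)

    private
      weight-bad : ∀ φ u → Bad φ u → badWeight φ u ≡ M (φ u)
      weight-bad φ u u-bad rewrite T⇒≡true (Bad⇒isBad φ u u-bad) = refl

      weight-good : ∀ φ u → ¬ Bad φ u → badWeight φ u ≡ 0
      weight-good φ u u-good with isBad φ u in status
      ... | true  = ⊥-elim (u-good (isBad⇒Bad φ u (subst T (sym status) tt)))
      ... | false = refl

      in-clique : ∀ j u → ¬ u ≡ x → ψ u ≡ j → T (adj x u) → cliqueWeight j u ≡ M j
      in-clique j u u≢x ψu≡j x~u rewrite ≢⇒==f u≢x | T⇒≡true (nbr-intro {ψ} {j} {x} {u} ψu≡j x~u) = refl

      not-in-clique : ∀ j u → ¬ u ≡ x → ¬ T (nbr ψ j x u) → cliqueWeight j u ≡ 0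
      not-in-clique j u u≢x u∉x with nbr ψ j x u in member
      ... | true  = ⊥-elim (u∉x tt)
      ... | false rewrite ≢⇒==f u≢x = refl

      non-adjacent : ∀ u → adj u x ≡ false → ¬ T (adj x u)
      non-adjacent u u≁x x~u = subst T u≁x (adj-sym x~u)

    -- Pointwise, the old clique of x is traded for its new one.
    exchange : ∀ u → badWeight ψ' u + cliqueWeight c u ≡ badWeight ψ u + cliqueWeight l u
    exchange u with toSum (u ≟ x)
    ... | inj₁ refl rewrite weight-bad ψ' u still-bad | weight-bad ψ u x-bad | ψ'x
                          | T⇒≡true (closedNbr-self ψ c u) | T⇒≡true (closedNbr-self ψ l u) = +-comm (M l) (M c)
    ... | inj₂ u≢x with adj u x in u~x
    ...   | false rewrite isBad-unaffected u u≢x (inj₁ u~x) | ψ'u u u≢x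
                        | not-in-clique c u u≢x (non-adjacent u u~x ∘ nbr-adj {ψ})
                        | not-in-clique l u u≢x (non-adjacent u u~x ∘ nbr-adj {ψ}) = refl
    ...   | true with toSum (ψ u ≟ c) | toSum (ψ u ≟ l)
    ...     | inj₁ ψu≡c | _ rewrite weight-good ψ' u (old-nbr-not-bad u ψu≡c (≡true⇒T u~x))
                              | weight-bad ψ u (proj₁ (bad-spreads ψ ψ-min x u x-bad (nbr-intro {ψ} ψu≡c (adj-sym (≡true⇒T u~x)))))
                              | in-clique c u u≢x ψu≡c (adj-sym (≡true⇒T u~x))
                              | not-in-clique l u u≢x (l≢c ∘ λ ψu≡l → trans (sym (nbr-colour {ψ} ψu≡l)) ψu≡c)
                              | ψu≡c = +-comm 0 (M c)
    ...     | inj₂ ψu≢c | inj₁ ψu≡l rewrite weight-bad ψ' u (new-nbr-becomes-bad u ψu≡l (≡true⇒T u~x))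
                              | weight-good ψ u (new-nbr-was-not-bad u ψu≡l (≡true⇒T u~x))
                              | in-clique l u u≢x ψu≡l (adj-sym (≡true⇒T u~x))
                              | not-in-clique c u u≢x (ψu≢c ∘ nbr-colour {ψ})
                              | ψ'u u u≢x | ψu≡l = +-identityʳ (M l)
    ...     | inj₂ ψu≢c | inj₂ ψu≢l rewrite isBad-unaffected u u≢x (inj₂ (ψu≢c , ψu≢l)) | ψ'u u u≢x
                              | not-in-clique c u u≢x (ψu≢c ∘ nbr-colour {ψ}) | not-in-clique l u u≢x (ψu≢l ∘ nbr-colour {ψ}) = refl

    P-unchanged : P ψ' ≡ P ψ
    P-unchanged = +-cancelʳ-≡ (prod (suc ∘ α)) (P ψ') (P ψ) (begin
      P ψ' + prod (suc ∘ α)                  ≡⟨ cong (P ψ' +_) (cliqueWeight-total c (bad-nbrCount ψ ψ-min x x-bad)) ⟨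
      P ψ' + sum (cliqueWeight c)            ≡⟨ ∑-distrib-+ (badWeight ψ') (cliqueWeight c) ⟨
      sum (λ u → badWeight ψ' u + cliqueWeight c u) ≡⟨ sum-cong-≗ exchange ⟩
      sum (λ u → badWeight ψ u + cliqueWeight l u)  ≡⟨ ∑-distrib-+ (badWeight ψ) (cliqueWeight l) ⟩
      P ψ + sum (cliqueWeight l)             ≡⟨ cong (P ψ +_) (cliqueWeight-total l x-nbrCount-l-exact) ⟩
      P ψ + prod (suc ∘ α)                   ∎)
      where open ≡-Reasoning

    still-good : Good ψ'
    still-good = Good-transfer ψ good ψ' F-unchanged P-unchanged

  cliqueOf : Col → V → V → Bool
  cliqueOf ψ x = closedNbr ψ (ψ x) x

  module BadClique (ψ : Col) (good : Good ψ) (x : V) (x-bad : Bad ψ x) where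
    private
      ψ-min : FMin ψ
      ψ-min = Good⇒FMin ψ good
      c : Fin k
      c = ψ x

    member-colour : ∀ y → T (cliqueOf ψ x y) → ψ y ≡ c
    member-colour y y∈K with closedNbr-cases {ψ} y∈K
    ... | inj₁ refl = refl
    ... | inj₂ y∈x  = nbr-colour {ψ} y∈x

    member-bad : ∀ y → T (cliqueOf ψ x y) → Bad ψ y
    member-bad y y∈K with closedNbr-cases {ψ} y∈K
    ... | inj₁ refl = x-bad
    ... | inj₂ y∈x  = proj₁ (bad-spreads ψ ψ-min x y x-bad y∈x)

    member-nbr-member : ∀ y u → T (cliqueOf ψ x y) → T (nbr ψ (ψ y) y u) → T (cliqueOf ψ x u)
    member-nbr-member y u y∈K u∈y with closedNbr-cases {ψ} y∈K
    ... | inj₁ refl = closedNbr-nbr {ψ} u∈y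
    ... | inj₂ y∈x with proj₂ (bad-spreads ψ ψ-min x y x-bad y∈x) u u∈y
    ...   | inj₁ refl        = closedNbr-self ψ c x
    ...   | inj₂ (u∈x , _)   = closedNbr-nbr {ψ} u∈x

    clique-size : count (cliqueOf ψ x) ≡ suc (α c)
    clique-size = trans (closedNbr-count ψ c x) (cong suc (bad-nbrCount ψ ψ-min x x-bad))

  NoSharedNbr : Col → V → Fin k → Set
  NoSharedNbr ψ x l = ∀ y₁ y₂ u → T (cliqueOf ψ x y₁) → T (cliqueOf ψ x y₂) → ¬ y₁ ≡ y₂ →
                      ψ u ≡ l → T (adj y₁ u) → T (adj y₂ u) → ⊥

  -- A vertex u of another colour l adjacent to two members y₁, y₂ of the clique K of x
  -- is adjacent to all of K: recolour y₁ to l, making u bad; then recolour u to the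
  -- colour of K; the clique of u then has α_c members and lies in K ∖ {y₁}, so it is K ∖ {y₁}.
  shared-nbr-sees-all : (ψ : Col) → Good ψ → (x : V) → Bad ψ x → (l : Fin k) → ¬ l ≡ ψ x →
    ∀ y₁ y₂ u → T (cliqueOf ψ x y₁) → T (cliqueOf ψ x y₂) → ¬ y₁ ≡ y₂ → ψ u ≡ l →
    T (adj y₁ u) → T (adj y₂ u) → ∀ q → T (cliqueOf ψ x q) → T (adj q u)
  shared-nbr-sees-all ψ good x x-bad l l≢c y₁ y₂ u y₁∈K y₂∈K y₁≢y₂ ψu≡l y₁~u y₂~u q q∈K with toSum (q ≟ y₁)
  ... | inj₁ refl  = y₁~u
  ... | inj₂ q≢y₁ = adj-sym (nbr-adj {ψ₂} (clique-of-u q (T-∧⁺ q∈K (≢⇒T≠ q≢y₁))))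
    where
    open BadClique ψ good x x-bad
    c : Fin k
    c = ψ x
    ψy₁≡c : ψ y₁ ≡ c
    ψy₁≡c = member-colour y₁ y₁∈K
    ψy₂≡c : ψ y₂ ≡ c
    ψy₂≡c = member-colour y₂ y₂∈K
    u≢y₁ : ¬ u ≡ y₁
    u≢y₁ = adj⇒≢ (adj-sym y₁~u)
    u≢y₂ : ¬ u ≡ y₂
    u≢y₂ = adj⇒≢ (adj-sym y₂~u)
    -- first move: y₁ to colour l; then u is in the new clique of y₁, hence bad
    module Move₁ = RecolourBad ψ good y₁ (member-bad y₁ y₁∈K) l (λ l≡ → l≢c (trans l≡ ψy₁≡c))
    ψ₁ : Col
    ψ₁ = recolour ψ y₁ l
    ψ₁u≡l : ψ₁ u ≡ l
    ψ₁u≡l = trans (recolour-other ψ y₁ l u u≢y₁) ψu≡l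
    u-bad₁ : Bad ψ₁ u
    u-bad₁ = BadClique.member-bad ψ₁ Move₁.still-good y₁ Move₁.still-bad u
               (closedNbr-nbr {ψ₁} (nbr-intro {ψ₁} (trans ψ₁u≡l (sym Move₁.ψ'x)) y₁~u))
    -- second move: u to colour c; u stays bad, with a clique of colour c containing y₂
    module Move₂ = RecolourBad ψ₁ Move₁.still-good u u-bad₁ c (λ c≡ → l≢c (sym (trans c≡ ψ₁u≡l)))
    ψ₂ : Col
    ψ₂ = recolour ψ₁ u c
    u-bad₂ : α c ≤ nbrCount ψ₂ c u × Clique ψ₂ c u
    u-bad₂ = bad-at ψ₂ u Move₂.ψ'x Move₂.still-bad
    ψ₂y₂≡c : ψ₂ y₂ ≡ c
    ψ₂y₂≡c = trans (recolour-other ψ₁ u c y₂ (u≢y₂ ∘ sym)) (trans (recolour-other ψ y₁ l y₂ (y₁≢y₂ ∘ sym)) ψy₂≡c)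
    y₂∈u : T (nbr ψ₂ c u y₂)
    y₂∈u = nbr-intro {ψ₂} ψ₂y₂≡c (adj-sym y₂~u)
    K-y₁ : V → Bool
    K-y₁ w = cliqueOf ψ x w ∧ not (w == y₁)
    u-nbr⊆K-y₁ : ∀ w → T (nbr ψ₂ c u w) → T (K-y₁ w)
    u-nbr⊆K-y₁ w w∈u with toSum (w ≟ y₂)
    ... | inj₁ refl = T-∧⁺ y₂∈K (≢⇒T≠ (y₁≢y₂ ∘ sym))
    ... | inj₂ w≢y₂ = T-∧⁺ w∈K (≢⇒T≠ w≢y₁)
      where
      w≢u : ¬ w ≡ u
      w≢u = adj⇒≢ (adj-sym (nbr-adj {ψ₂} w∈u))
      ψ₂w≡c : ψ₂ w ≡ c
      ψ₂w≡c = nbr-colour {ψ₂} w∈u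
      w≢y₁ : ¬ w ≡ y₁
      w≢y₁ w≡y₁ = l≢c (trans (sym Move₁.ψ'x) (trans (sym (recolour-other ψ₁ u c y₁ (u≢y₁ ∘ sym)))
                        (trans (cong ψ₂ (sym w≡y₁)) ψ₂w≡c)))
      ψw≡c : ψ w ≡ c
      ψw≡c = trans (sym (recolour-other ψ y₁ l w w≢y₁)) (trans (sym (recolour-other ψ₁ u c w w≢u)) ψ₂w≡c)
      w∈K : T (cliqueOf ψ x w)
      w∈K = member-nbr-member y₂ w y₂∈K
              (nbr-intro {ψ} (trans ψw≡c (sym ψy₂≡c)) (proj₂ u-bad₂ y₂ w y₂∈u w∈u (w≢y₂ ∘ sym)))
    #K-y₁ : count K-y₁ ≡ α c
    #K-y₁ = suc-injective (trans (sym (count-remove (cliqueOf ψ x) y₁ y₁∈K)) clique-size)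
    clique-of-u : ∀ w → T (K-y₁ w) → T (nbr ψ₂ c u w)
    clique-of-u = count-tight u-nbr⊆K-y₁ (≤-trans (≤-reflexive #K-y₁) (proj₁ u-bad₂))

  clique-nbr : (ψ : Col) (x : V) → Bad ψ x → Σ V (λ y → T (nbr ψ (ψ x) x y))
  clique-nbr ψ x x-bad = count-witness (nbr ψ (ψ x) x) (≤-trans (s≤s z≤n) (≤-trans (α≥2 (ψ x)) (proj₁ x-bad)))

  clique-nbr-avoiding : (ψ : Col) (x v : V) → Bad ψ x → Σ V (λ y → T (nbr ψ (ψ x) x y) × ¬ y ≡ v)
  clique-nbr-avoiding ψ x v x-bad with nbr ψ (ψ x) x v in v∈x
  ... | false = y , y∈x , λ y≡v → subst T (trans (cong (nbr ψ (ψ x) x) y≡v) v∈x) y∈x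
    where
    y : V
    y = proj₁ (clique-nbr ψ x x-bad)
    y∈x : T (nbr ψ (ψ x) x y)
    y∈x = proj₂ (clique-nbr ψ x x-bad)
  ... | true = y , proj₁ (T-∧⁻ y-ok) , T≠⇒≢ (proj₂ (T-∧⁻ y-ok))
    where
    others-exist : 0 < count (λ i → nbr ψ (ψ x) x i ∧ not (i == v))
    others-exist = ≤-pred (≤-trans (α≥2 (ψ x)) (≤-trans (proj₁ x-bad)
                     (≤-reflexive (count-remove (nbr ψ (ψ x) x) v (≡true⇒T v∈x)))))
    others : Σ V (λ i → T (nbr ψ (ψ x) x i ∧ not (i == v)))
    others = count-witness (λ i → nbr ψ (ψ x) x i ∧ not (i == v)) others-exist
    y : V
    y = proj₁ others
    y-ok : T (nbr ψ (ψ x) x y ∧ not (y == v))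
    y-ok = proj₂ others

  noSharedNbr-moves : (ψ : Col) (good : Good ψ) (x : V) (x-bad : Bad ψ x) (l : Fin k) (l≢c : ¬ l ≡ ψ x) →
    NoSharedNbr ψ x l → (y : V) → T (nbr ψ (ψ x) x y) → NoSharedNbr (recolour ψ y l) y (ψ x)
  noSharedNbr-moves ψ good x x-bad l l≢c none y y∈x y₁ y₂ u y₁∈K' y₂∈K' y₁≢y₂ ψ'u≡c y₁~u y₂~u =
    none y u q (closedNbr-nbr {ψ} y∈x) u∈K (u≢y ∘ sym) ψq≡l y~q u~q
    where
    open BadClique ψ good x x-bad
    c : Fin k
    c = ψ x
    ψy≡c : ψ y ≡ c
    ψy≡c = nbr-colour {ψ} y∈x
    module Move = RecolourBad ψ good y (member-bad y (closedNbr-nbr {ψ} y∈x)) l (λ l≡ → l≢c (trans l≡ ψy≡c))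
    ψ' : Col
    ψ' = recolour ψ y l
    -- u is adjacent to the whole new clique of y, in particular to y
    sees-all : ∀ q → T (cliqueOf ψ' y q) → T (adj q u)
    sees-all = shared-nbr-sees-all ψ' Move.still-good y Move.still-bad c (λ c≡ → l≢c (trans (sym Move.ψ'x) (sym c≡)))
                 y₁ y₂ u y₁∈K' y₂∈K' y₁≢y₂ ψ'u≡c y₁~u y₂~u
    y~u : T (adj y u)
    y~u = sees-all y (closedNbr-self ψ' (ψ' y) y)
    u≢y : ¬ u ≡ y
    u≢y u≡y = adj⇒≢ y~u (sym u≡y)
    u∈K : T (cliqueOf ψ x u)
    u∈K = member-nbr-member y u (closedNbr-nbr {ψ} y∈x)
            (nbr-intro {ψ} (trans (trans (sym (recolour-other ψ y l u u≢y)) ψ'u≡c) (sym ψy≡c)) y~u)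
    -- and some new clique neighbour q of y (of colour l) is shared by y and u
    q : V
    q = proj₁ (clique-nbr ψ' y Move.still-bad)
    q∈y : T (nbr ψ' (ψ' y) y q)
    q∈y = proj₂ (clique-nbr ψ' y Move.still-bad)
    q≢y : ¬ q ≡ y
    q≢y = adj⇒≢ (adj-sym (nbr-adj {ψ'} q∈y))
    ψq≡l : ψ q ≡ l
    ψq≡l = trans (sym (recolour-other ψ y l q q≢y)) (trans (nbr-colour {ψ'} q∈y) Move.ψ'x)
    y~q : T (adj y q)
    y~q = nbr-adj {ψ'} q∈y
    u~q : T (adj u q)
    u~q = adj-sym (sees-all q (closedNbr-nbr {ψ'} q∈y))

  -- The clique of a bad vertex x of a good colouring has a shared neighbour of every
  -- other colour B. Otherwise repeatedly moving a clique neighbour of the current bad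
  -- vertex to the other one of the two colours A = ψ x, B produces ever new cliques of
  -- unvisited vertices, which is impossible in a finite graph.
  module Chain (ψ₀ : Col) (good₀ : Good ψ₀) (x₀ : V) (x₀-bad : Bad ψ₀ x₀) (B : Fin k) (B≢A : ¬ B ≡ ψ₀ x₀)
               (none₀ : NoSharedNbr ψ₀ x₀ B) where
    A : Fin k
    A = ψ₀ x₀

    other : Fin k → Fin k
    other c = if c == A then B else A

    AB : Fin k → Set
    AB c = c ≡ A ⊎ c ≡ B

    other-A : other A ≡ B
    other-A rewrite ==-refl A = refl

    other-B : other B ≡ A
    other-B rewrite ≢⇒==f B≢A = refl

    other-other : ∀ {c} → AB c → other (other c) ≡ c
    other-other (inj₁ refl) = trans (cong other other-A) other-B
    other-other (inj₂ refl) = trans (cong other other-B) other-A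

    other-≢ : ∀ {c} → AB c → ¬ other c ≡ c
    other-≢ (inj₁ refl) eq = B≢A (trans (sym other-A) eq)
    other-≢ (inj₂ refl) eq = B≢A (sym (trans (sym other-B) eq))

    other-AB : ∀ {c} → AB c → AB (other c)
    other-AB (inj₁ refl) = inj₂ other-A
    other-AB (inj₂ refl) = inj₁ other-B

    -- Old vertices are the visited ones outside the
    -- current clique; the old region is closed under same-colour neighbourhoods and
    -- no vertex outside it of the other colour (except x) sees two adjacent old
    -- vertices of one colour.
    record State (t : ℕ) : Set where
      field
        ψ         : Col
        x         : V
        good      : Good ψ
        x-bad     : Bad ψ x
        colour-AB : AB (ψ x)
        no-shared : NoSharedNbr ψ x (other (ψ x))
        visited   : V → Bool
        clique⊆visited : ∀ v → T (cliqueOf ψ x v) → T (visited v)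
      Old : V → Set
      Old v = T (visited v) × ¬ T (cliqueOf ψ x v)
      field
        old-closed    : ∀ v u → Old v → T (nbr ψ (ψ v) v u) → Old u
        old-no-shared : ∀ u v v' → ¬ Old u → ¬ u ≡ x → Old v → Old v' → ¬ v ≡ v' → ψ v ≡ ψ v' →
                        T (adj v v') → T (adj u v) → T (adj u v') → ψ u ≡ other (ψ v) → ⊥
        size          : t < count visited

    start : State 0
    start = record
      { ψ = ψ₀ ; x = x₀ ; good = good₀ ; x-bad = x₀-bad ; colour-AB = inj₁ refl
      ; no-shared = λ y₁ y₂ u y₁∈K y₂∈K y₁≢y₂ ψu≡ → none₀ y₁ y₂ u y₁∈K y₂∈K y₁≢y₂ (trans ψu≡ other-A)
      ; visited = cliqueOf ψ₀ x₀ ; clique⊆visited = λ v v∈K → v∈K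
      ; old-closed = λ v u old → ⊥-elim (proj₂ old (proj₁ old))
      ; old-no-shared = λ u v v' _ _ old → ⊥-elim (proj₂ old (proj₁ old))
      ; size = subst (0 <_) (sym (count-remove (cliqueOf ψ₀ x₀) x₀ (closedNbr-self ψ₀ A x₀))) (s≤s z≤n)
      }

    module Step {t : ℕ} (S : State t) where
      open State S
      open BadClique ψ good x x-bad
      c c' : Fin k
      c  = ψ x
      c' = other c
      c'≢c : ¬ c' ≡ c
      c'≢c = other-≢ colour-AB
      other-c' : other c' ≡ c
      other-c' = other-other colour-AB

      x' : V
      x' = proj₁ (clique-nbr ψ x x-bad)
      x'∈x : T (nbr ψ c x x')
      x'∈x = proj₂ (clique-nbr ψ x x-bad)
      x'∈K : T (cliqueOf ψ x x')
      x'∈K = closedNbr-nbr {ψ} x'∈x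
      ψx'≡c : ψ x' ≡ c
      ψx'≡c = member-colour x' x'∈K
      x'≢x : ¬ x' ≡ x
      x'≢x = adj⇒≢ (adj-sym (nbr-adj {ψ} x'∈x))

      module Move = RecolourBad ψ good x' (member-bad x' x'∈K) c' (λ c'≡ → c'≢c (trans c'≡ ψx'≡c))
      ψ' : Col
      ψ' = recolour ψ x' c'
      ψ'x' : ψ' x' ≡ c'
      ψ'x' = Move.ψ'x
      ψ'u : ∀ u → ¬ u ≡ x' → ψ' u ≡ ψ u
      ψ'u = Move.ψ'u

      new-member-colour : ∀ v → T (nbr ψ' (ψ' x') x' v) → ψ v ≡ c'
      new-member-colour v v∈x' = trans (sym (ψ'u v (adj⇒≢ (adj-sym (nbr-adj {ψ'} v∈x'))))) (trans (nbr-colour {ψ'} v∈x') ψ'x')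

      -- The new clique neighbours of x' have not been visited: an old one, together with
      -- a second one in its colour-c' clique, would be a pair shared by x'.
      fresh : ∀ v → T (nbr ψ' (ψ' x') x' v) → ¬ T (visited v)
      fresh v v∈x' v-visited =
        old-no-shared x' v v' (λ x'-old → proj₂ x'-old x'∈K) x'≢x v-old v'-old (v'≢v ∘ sym)
          (trans ψv≡c' (sym ψv'≡c')) v~v' (nbr-adj {ψ'} v∈x') (nbr-adj {ψ'} v'∈x')
          (trans ψx'≡c (trans (sym other-c') (cong other (sym ψv≡c'))))
        where
        ψv≡c' : ψ v ≡ c'
        ψv≡c' = new-member-colour v v∈x'
        v-old : Old v
        v-old = v-visited , λ v∈K → c'≢c (trans (sym ψv≡c') (member-colour v v∈K))
        v'-and : Σ V (λ y → T (nbr ψ' (ψ' x') x' y) × ¬ y ≡ v)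
        v'-and = clique-nbr-avoiding ψ' x' v Move.still-bad
        v' : V
        v' = proj₁ v'-and
        v'∈x' : T (nbr ψ' (ψ' x') x' v')
        v'∈x' = proj₁ (proj₂ v'-and)
        v'≢v : ¬ v' ≡ v
        v'≢v = proj₂ (proj₂ v'-and)
        v~v' : T (adj v v')
        v~v' = proj₂ Move.still-bad v v' v∈x' v'∈x' (v'≢v ∘ sym)
        ψv'≡c' : ψ v' ≡ c'
        ψv'≡c' = new-member-colour v' v'∈x'
        v'-old : Old v'
        v'-old = old-closed v v' v-old (nbr-intro {ψ} (trans ψv'≡c' (sym ψv≡c')) v~v')

      visited' : V → Bool
      visited' v = visited v ∨ cliqueOf ψ' x' v

      Old' : V → Set
      Old' v = T (visited' v) × ¬ T (cliqueOf ψ' x' v)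

      old'⇒visited : ∀ {v} → Old' v → T (visited v)
      old'⇒visited {v} (v-visited' , v∉K') with T-∨⁻ {visited v} v-visited'
      ... | inj₁ v-visited = v-visited
      ... | inj₂ v∈K'      = ⊥-elim (v∉K' v∈K')

      visited-not-new : ∀ u → T (visited u) → ¬ u ≡ x' → ¬ T (cliqueOf ψ' x' u)
      visited-not-new u u-visited u≢x' u∈K' with closedNbr-cases {ψ'} u∈K'
      ... | inj₁ u≡x' = u≢x' u≡x'
      ... | inj₂ u∈x' = fresh u u∈x' u-visited

      old'-≢x' : ∀ {v} → Old' v → ¬ v ≡ x'
      old'-≢x' (_ , v∉K') refl = v∉K' (closedNbr-self ψ' (ψ' x') x')

      old'-closed : ∀ v u → Old' v → T (nbr ψ' (ψ' v) v u) → Old' u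
      old'-closed v u v-old' u∈v with T? (cliqueOf ψ x v)
      ... | yes v∈K = T-∨⁺ (inj₁ (clique⊆visited u u∈K)) , visited-not-new u (clique⊆visited u u∈K) u≢x'
        where
        u≢x' : ¬ u ≡ x'
        u≢x' u≡x' = c'≢c (trans (sym ψ'x') (trans (cong ψ' (sym u≡x'))
                      (trans (nbr-colour {ψ'} u∈v) (trans (ψ'u v (old'-≢x' v-old')) (member-colour v v∈K)))))
        u∈K : T (cliqueOf ψ x u)
        u∈K = member-nbr-member v u v∈K (nbr-intro {ψ}
                (trans (sym (ψ'u u u≢x')) (trans (nbr-colour {ψ'} u∈v) (ψ'u v (old'-≢x' v-old')))) (nbr-adj {ψ'} u∈v))
      ... | no v∉K with toSum (u ≟ x')
      ...   | inj₁ refl = ⊥-elim (fresh v (nbr-intro {ψ'} (sym (nbr-colour {ψ'} u∈v)) (adj-sym (nbr-adj {ψ'} u∈v)))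
                                        (old'⇒visited v-old'))
      ...   | inj₂ u≢x' = T-∨⁺ (inj₁ (proj₁ u-old)) , visited-not-new u (proj₁ u-old) u≢x'
        where
        u-old : Old u
        u-old = old-closed v u (old'⇒visited v-old' , v∉K)
                  (nbr-intro {ψ} (trans (sym (ψ'u u u≢x')) (trans (nbr-colour {ψ'} u∈v) (ψ'u v (old'-≢x' v-old'))))
                                 (nbr-adj {ψ'} u∈v))

      old'-no-shared : ∀ u v v' → ¬ Old' u → ¬ u ≡ x' → Old' v → Old' v' → ¬ v ≡ v' → ψ' v ≡ ψ' v' →
                       T (adj v v') → T (adj u v) → T (adj u v') → ψ' u ≡ other (ψ' v) → ⊥
      old'-no-shared u v v' u-not-old' u≢x' v-old' v'-old' v≢v' same-colour' v~v' u~v u~v' ψ'u≡ =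
        by-cases (T? (cliqueOf ψ x v)) (T? (cliqueOf ψ x v'))
        where
        u-unvisited : ¬ T (visited u)
        u-unvisited u-visited = u-not-old' (T-∨⁺ (inj₁ u-visited) , visited-not-new u u-visited u≢x')
        u≢x : ¬ u ≡ x
        u≢x refl = u-unvisited (clique⊆visited x (closedNbr-self ψ c x))
        ψ'v≡ψv : ψ' v ≡ ψ v
        ψ'v≡ψv = ψ'u v (old'-≢x' v-old')
        same-colour : ψ v ≡ ψ v'
        same-colour = trans (sym ψ'v≡ψv) (trans same-colour' (ψ'u v' (old'-≢x' v'-old')))
        ψu≡ : ψ u ≡ other (ψ v)
        ψu≡ = trans (sym (ψ'u u u≢x')) (trans ψ'u≡ (cong other ψ'v≡ψv))
        by-cases : Dec (T (cliqueOf ψ x v)) → Dec (T (cliqueOf ψ x v')) → ⊥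
        by-cases (no v∉K) (no v'∉K) = old-no-shared u v v' (u-unvisited ∘ proj₁) u≢x
          (old'⇒visited v-old' , v∉K) (old'⇒visited v'-old' , v'∉K) v≢v' same-colour v~v' u~v u~v' ψu≡
        by-cases (yes v∈K) (yes v'∈K) = no-shared v v' u v∈K v'∈K v≢v'
          (trans ψu≡ (cong other (member-colour v v∈K))) (adj-sym u~v) (adj-sym u~v')
        by-cases (yes v∈K) (no v'∉K) = v'∉K (member-nbr-member v v' v∈K (nbr-intro {ψ} (sym same-colour) v~v'))
        by-cases (no v∉K) (yes v'∈K) = v∉K (member-nbr-member v' v v'∈K (nbr-intro {ψ} same-colour (adj-sym v~v')))

      grows : suc t < count visited'
      grows = ≤-trans (s≤s size) (count-strict {P = visited} {Q = visited'} (λ i i-visited → T-∨⁺ (inj₁ i-visited)) v₀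
                (T-∨⁺ {visited v₀} (inj₂ (closedNbr-nbr {ψ'} v₀∈x'))) (fresh v₀ v₀∈x'))
        where
        v₀ : V
        v₀ = proj₁ (clique-nbr ψ' x' Move.still-bad)
        v₀∈x' : T (nbr ψ' (ψ' x') x' v₀)
        v₀∈x' = proj₂ (clique-nbr ψ' x' Move.still-bad)

      next : State (suc t)
      next = record
        { ψ = ψ' ; x = x' ; good = Move.still-good ; x-bad = Move.still-bad
        ; colour-AB = subst AB (sym ψ'x') (other-AB colour-AB)
        ; no-shared = λ y₁ y₂ u y₁∈ y₂∈ y₁≢y₂ ψ'u≡ →
            noSharedNbr-moves ψ good x x-bad c' c'≢c no-shared x' x'∈x y₁ y₂ u y₁∈ y₂∈ y₁≢y₂
              (trans ψ'u≡ (trans (cong other ψ'x') other-c'))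
        ; visited = visited' ; clique⊆visited = λ v v∈K' → T-∨⁺ {visited v} (inj₂ v∈K')
        ; old-closed = old'-closed ; old-no-shared = old'-no-shared ; size = grows }

    -- After n moves more than n vertices would have been visited.
    states : ∀ t → State t
    states zero    = start
    states (suc t) = Step.next (states t)

    impossible : ⊥
    impossible = <⇒≱ (State.size (states (Graph.n G))) (count-≤ (State.visited (states (Graph.n G))))

  SharedNbr : Col → V → Fin k → V → V → V → Set
  SharedNbr ψ x l y₁ y₂ u = T (cliqueOf ψ x y₁) × T (cliqueOf ψ x y₂) × ¬ y₁ ≡ y₂ × ψ u ≡ l × T (adj y₁ u) × T (adj y₂ u)

  sharedNbr? : ∀ ψ x l → Dec (∃ λ y₁ → ∃ λ y₂ → ∃ λ u → SharedNbr ψ x l y₁ y₂ u)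
  sharedNbr? ψ x l = FinP.any? λ y₁ → FinP.any? λ y₂ → FinP.any? λ u →
    T? (cliqueOf ψ x y₁) ×-dec T? (cliqueOf ψ x y₂) ×-dec ¬? (y₁ ≟ y₂) ×-dec (ψ u ≟ l) ×-dec T? (adj y₁ u) ×-dec T? (adj y₂ u)

  sharedNbr-exists : (ψ : Col) → Good ψ → (x : V) → Bad ψ x → (l : Fin k) → ¬ l ≡ ψ x →
    ∃ λ y₁ → ∃ λ y₂ → ∃ λ u → SharedNbr ψ x l y₁ y₂ u
  sharedNbr-exists ψ good x x-bad l l≢c with sharedNbr? ψ x l
  ... | yes found = found
  ... | no none = ⊥-elim (Chain.impossible ψ good x x-bad l l≢c
                    (λ y₁ y₂ u a b c d e f → none (y₁ , y₂ , u , a , b , c , d , e , f)))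

  -- Every member q of the clique of a bad vertex x is adjacent to every neighbour w of x
  -- of another colour m: a shared neighbour u of colour m sees all of the clique; if
  -- w ≠ u, recolour x to m, so that u and w join the clique of x and q (adjacent to x
  -- and u) becomes a shared neighbour of the other colour, seeing w as well.
  clique-sees-nbrs : (ψ : Col) → Good ψ → (x : V) → Bad ψ x → (m : Fin k) → ¬ m ≡ ψ x →
    ∀ q w → T (cliqueOf ψ x q) → ψ w ≡ m → T (adj x w) → T (adj q w)
  clique-sees-nbrs ψ good x x-bad m m≢c q w q∈K ψw≡m x~w
    with sharedNbr-exists ψ good x x-bad m m≢c
  ... | y₁ , y₂ , u , y₁∈K , y₂∈K , y₁≢y₂ , ψu≡m , y₁~u , y₂~u with toSum (w ≟ u)
  ...   | inj₁ refl = shared-nbr-sees-all ψ good x x-bad m m≢c y₁ y₂ u y₁∈K y₂∈K y₁≢y₂ ψu≡m y₁~u y₂~u q q∈K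
  ...   | inj₂ w≢u with closedNbr-cases {ψ} q∈K
  ...     | inj₁ refl = x~w
  ...     | inj₂ q∈x  = adj-sym (q-sees-new-clique w w∈K')
    where
    sees-u : ∀ q → T (cliqueOf ψ x q) → T (adj q u)
    sees-u = shared-nbr-sees-all ψ good x x-bad m m≢c y₁ y₂ u y₁∈K y₂∈K y₁≢y₂ ψu≡m y₁~u y₂~u
    module Move = RecolourBad ψ good x x-bad m m≢c
    ψ' : Col
    ψ' = recolour ψ x m
    x~u : T (adj x u)
    x~u = sees-u x (closedNbr-self ψ (ψ x) x)
    u≢x : ¬ u ≡ x
    u≢x = adj⇒≢ (adj-sym x~u)
    new-member : ∀ v → ψ v ≡ m → T (adj x v) → T (cliqueOf ψ' x v)
    new-member v ψv≡m x~v = closedNbr-nbr {ψ'}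
      (nbr-intro {ψ'} (trans (Move.ψ'u v (adj⇒≢ (adj-sym x~v))) (trans ψv≡m (sym Move.ψ'x))) x~v)
    u∈K' : T (cliqueOf ψ' x u)
    u∈K' = new-member u ψu≡m x~u
    w∈K' : T (cliqueOf ψ' x w)
    w∈K' = new-member w ψw≡m x~w
    q≢x : ¬ q ≡ x
    q≢x = adj⇒≢ (adj-sym (nbr-adj {ψ} q∈x))
    q-sees-new-clique : ∀ v → T (cliqueOf ψ' x v) → T (adj v q)
    q-sees-new-clique = shared-nbr-sees-all ψ' Move.still-good x Move.still-bad (ψ x)
      (λ c≡ → m≢c (sym (trans c≡ Move.ψ'x)))
      x u q (closedNbr-self ψ' (ψ' x) x) u∈K' (u≢x ∘ sym)
      (trans (Move.ψ'u q q≢x) (nbr-colour {ψ} q∈x)) (nbr-adj {ψ} q∈x) (adj-sym (sees-u q q∈K))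

  module ClosedNbhd (ψ : Col) (good : Good ψ) (x : V) (x-bad : Bad ψ x) where
    private
      c : Fin k
      c = ψ x

    closed : V → Bool
    closed u = (u == x) ∨ adj x u

    -- Recolouring x to m shows that x has at least α_m neighbours of colour m.
    nbrCount-≥ : ∀ m → α m ≤ nbrCount ψ m x
    nbrCount-≥ m with m ≟ c
    ... | yes refl = proj₁ x-bad
    ... | no m≢c   = ≤-trans (proj₁ (bad-at (recolour ψ x m) x Move.ψ'x Move.still-bad)) (≤-reflexive Move.x-nbrCount-l)
      where module Move = RecolourBad ψ good x x-bad m m≢c

    nbrs-by-colour : count (adj x) ≡ sum (λ m → nbrCount ψ m x)
    nbrs-by-colour = trans (sum-partition ψ (ind ∘ adj x))
                           (sum-cong-≗ (λ m → sum-cong-≗ (λ u → sym (ind-∧ (ψ u == m) (adj x u)))))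

    size : D + 1 ≤ count closed
    size = begin
      D + 1                          ≡⟨ +-comm D 1 ⟩
      suc D                          ≡⟨ cong suc (trans D≡Σα (Σ≡sum α)) ⟩
      suc (sum α)                    ≤⟨ s≤s (sum-mono nbrCount-≥) ⟩
      suc (sum (λ m → nbrCount ψ m x)) ≡⟨ cong suc nbrs-by-colour ⟨
      suc (count (adj x))            ≡⟨ count-insert (adj x) x (λ x~x → adj⇒≢ x~x refl) ⟨
      count closed                   ∎
      where open ≤-Reasoning

    -- Two neighbours u, w of x are adjacent: if u has the colour of x, by the clique
    -- of x or clique-sees-nbrs; otherwise after recolouring x to the colour of u.
    pairwise-adjacent : ∀ u w → T (closed u) → T (closed w) → ¬ u ≡ w → T (adj u w)
    pairwise-adjacent u w u∈ w∈ u≢w with T-∨⁻ {u == x} u∈ | T-∨⁻ {w == x} w∈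
    ... | inj₁ u=x | inj₁ w=x = ⊥-elim (u≢w (trans (==⇒≡ (T⇒≡true u=x)) (sym (==⇒≡ (T⇒≡true w=x)))))
    ... | inj₁ u=x | inj₂ x~w = subst (λ z → T (adj z w)) (sym (==⇒≡ (T⇒≡true u=x))) x~w
    ... | inj₂ x~u | inj₁ w=x = subst (λ z → T (adj u z)) (sym (==⇒≡ (T⇒≡true w=x))) (adj-sym x~u)
    ... | inj₂ x~u | inj₂ x~w with toSum (ψ u ≟ c) | toSum (ψ w ≟ c)
    ...   | inj₁ ψu≡c | inj₁ ψw≡c = proj₂ x-bad u w (nbr-intro {ψ} ψu≡c x~u) (nbr-intro {ψ} ψw≡c x~w) u≢w
    ...   | inj₁ ψu≡c | inj₂ ψw≢c = clique-sees-nbrs ψ good x x-bad (ψ w) ψw≢c u w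
                                      (closedNbr-nbr {ψ} (nbr-intro {ψ} ψu≡c x~u)) refl x~w
    ...   | inj₂ ψu≢c | _ with toSum (ψ w ≟ ψ u)
    ...     | inj₁ ψw≡ψu = proj₂ (bad-at ψ' x Move.ψ'x Move.still-bad) u w (new-nbr u refl x~u) (new-nbr w ψw≡ψu x~w) u≢w
      where
      module Move = RecolourBad ψ good x x-bad (ψ u) ψu≢c
      ψ' : Col
      ψ' = recolour ψ x (ψ u)
      new-nbr : ∀ v → ψ v ≡ ψ u → T (adj x v) → T (nbr ψ' (ψ u) x v)
      new-nbr v ψv≡ x~v = nbr-intro {ψ'} (trans (Move.ψ'u v (adj⇒≢ (adj-sym x~v))) ψv≡) x~v
    ...     | inj₂ ψw≢ψu = clique-sees-nbrs ψ' Move.still-good x Move.still-bad (ψ w)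
                             (λ ψw≡ → ψw≢ψu (trans ψw≡ Move.ψ'x)) u w
                             (closedNbr-nbr {ψ'} (nbr-intro {ψ'} (trans (Move.ψ'u u (adj⇒≢ (adj-sym x~u))) (sym Move.ψ'x)) x~u))
                             (Move.ψ'u w (adj⇒≢ (adj-sym x~w))) x~w
      where
      module Move = RecolourBad ψ good x x-bad (ψ u) ψu≢c
      ψ' : Col
      ψ' = recolour ψ x (ψ u)

    clique : Σ (Fin (D + 1) → V) (IsClique G (D + 1))
    clique with count-enumerate closed size
    ... | f , f-inj , f-closed = f , λ a b a≢b → adj⇒Adj (pairwise-adjacent (f a) (f b) (f-closed a) (f-closed b) (a≢b ∘ f-inj))

  -- In an F-minimal colouring, a clique of colour i on α_i + 1 vertices consists of bad
  -- vertices: its vertices have α_i neighbours of colour i inside it, hence no others.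
  mono-clique-bad : ∀ ψ → FMin ψ → ∀ i (cl : Fin (α i + 1) → V) → IsClique G (α i + 1) cl →
    (∀ a → ψ (cl a) ≡ i) → Σ V (Bad ψ)
  mono-clique-bad ψ ψ-min i cl cl-clique cl-colour = x , at-bad ψ x (cl-colour a₀) (α≤# , x-clique)
    where
    a₀ : Fin (α i + 1)
    a₀ = fromℕ< (m≤n+m 1 (α i))
    x : V
    x = cl a₀
    cl-inj : ∀ {a b} → cl a ≡ cl b → a ≡ b
    cl-inj {a} {b} cla≡clb with a ≟ b
    ... | yes a≡b = a≡b
    ... | no a≢b  = ⊥-elim (adj⇒≢ (Adj⇒adj (cl-clique a b a≢b)) cla≡clb)
    in-closed : ∀ a → T (closedNbr ψ i x (cl a))
    in-closed a with toSum (a ≟ a₀)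
    ... | inj₁ refl = closedNbr-self ψ i x
    ... | inj₂ a≢a₀ = closedNbr-nbr {ψ} (nbr-intro {ψ} (cl-colour a) (Adj⇒adj (cl-clique a₀ a (a≢a₀ ∘ sym))))
    α≤# : α i ≤ nbrCount ψ i x
    α≤# = ≤-pred (subst₂ _≤_ (+-comm (α i) 1) (closedNbr-count ψ i x)
                   (count-injection (closedNbr ψ i x) cl cl-inj in-closed))
    inImage : V → Bool
    inImage u = ⌊ FinP.any? (λ a → cl a ≟ u) ⌋
    image⊆closed : ∀ u → T (inImage u) → T (closedNbr ψ i x u)
    image⊆closed u u∈ with toWitness u∈
    ... | a , refl = in-closed a
    closed⊆image : ∀ u → T (closedNbr ψ i x u) → T (inImage u)
    closed⊆image = count-tight image⊆closed (begin
      count (closedNbr ψ i x)  ≡⟨ closedNbr-count ψ i x ⟩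
      suc (nbrCount ψ i x)     ≤⟨ s≤s (subst (λ j → nbrCount ψ j x ≤ α j) (cl-colour a₀) (nbrCount-own-≤ ψ ψ-min x)) ⟩
      suc (α i)                ≡⟨ +-comm 1 (α i) ⟩
      α i + 1                  ≤⟨ count-injection inImage cl cl-inj (λ a → fromWitness (a , refl)) ⟩
      count inImage            ∎)
      where open ≤-Reasoning
    x-clique : Clique ψ i x
    x-clique u w u∈x w∈x u≢w with toWitness (closed⊆image u (closedNbr-nbr {ψ} u∈x))
                                | toWitness (closed⊆image w (closedNbr-nbr {ψ} w∈x))
    ... | a , refl | b , refl = Adj⇒adj (cl-clique a b (u≢w ∘ cong cl))

  good-exists : 1 ≤ k → Σ Col Good
  good-exists k≥1 with ArgMin.argmin-Fun⁺ lex k≥1 (Graph.n G) (λ ψ → F ψ , P ψ) (λ ψ φ ψ≗φ → cong₂ _,_ (F-cong ψ φ ψ≗φ) (P-cong ψ φ ψ≗φ))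
    where
    P-cong : ∀ ψ φ → (∀ u → ψ u ≡ φ u) → P ψ ≡ P φ
    P-cong ψ φ ψ≗φ = sum-cong-≗ same-weight
      where
      same-weight : ∀ v → badWeight ψ v ≡ badWeight φ v
      same-weight v rewrite isBad-cong φ ψ v (ψ≗φ v) (λ u → cong (λ z → (z == φ v) ∧ adj v u) (ψ≗φ u)) | ψ≗φ v = refl
  ... | ξ , ξ-min = ξ , λ ψ → lex⇒ (ξ-min ψ)
    where
    lex⇒ : ∀ {ψ} → TotalPreorder._≲_ lex (F ξ , P ξ) (F ψ , P ψ) → F ξ < F ψ ⊎ (F ξ ≡ F ψ × P ξ ≤ P ψ)
    lex⇒ (inj₁ (F≤ , F≢)) = inj₁ (≤∧≢⇒< F≤ F≢)
    lex⇒ (inj₂ F≡P≤)      = inj₂ F≡P≤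

theorem2 : (G : Graph) → (D k : ℕ) → (α : Fin k → ℕ)
    → 1 ≤ k
    → (∀ i → 2 ≤ α i)
    → D ≡ Σ[ α ]
    → (∀ v → deg G v ≤ D)
    → ¬ (Σ (Fin (D + 1) → Fin (Graph.n G)) λ c → IsClique G (D + 1) c)
    → Σ (Coloring G k) λ ξ →
        (∀ ψ → Φ G α ξ ℚ.≤ Φ G α ψ)
        × (∀ i → ¬ (Σ (Fin (α i + 1) → Fin (Graph.n G)) λ c →
              IsClique G (α i + 1) c × (∀ a → ξ (c a) ≡ i)))
theorem2 G D k α k≥1 α≥2 D≡Σα Δ≤D no-big-clique = ξ , Φ-minimal , no-mono-clique
  where
  open Potential G α
  open Optimal G α α≥2 D D≡Σα Δ≤D
  ξ : Coloring G k
  ξ = proj₁ (good-exists k≥1)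
  ξ-good : Good ξ
  ξ-good = proj₂ (good-exists k≥1)
  Φ-minimal : ∀ ψ → Φ G α ξ ℚ.≤ Φ G α ψ
  Φ-minimal ψ = Φ-mono α-pos ξ ψ (Good⇒FMin ξ ξ-good ψ)
  -- a monochromatic K_{α_i + 1} would contain a bad vertex, whose closed
  -- neighbourhood is a K_{D + 1}
  no-mono-clique : ∀ i → ¬ (Σ (Fin (α i + 1) → Fin (Graph.n G)) λ c → IsClique G (α i + 1) c × (∀ a → ξ (c a) ≡ i))
  no-mono-clique i (cl , cl-clique , cl-colour) with mono-clique-bad ξ (Good⇒FMin ξ ξ-good) i cl cl-clique cl-colour
  ... | x , x-bad = no-big-clique (ClosedNbhd.clique ξ ξ-good x x-bad)
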